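{- Let $q=p^n$ with $p$ an odd prime, let $\alpha,\beta\in GF(q^2)$ with $\alpha\neq0$ and $4N(\alpha)+(\overline{\beta}-\beta)^2$ a non-square in $GF(q)$, and let $\lambda\in\{1,w\}$ and $P_\lambda=[0,\lambda\epsilon,1]$. For $z\in GF(q^2)$ let $Q_z=[z,\,T(\alpha z^2)-\lambda\epsilon,\,1]$. Let $x,y\in GF(q^2)$ be such that $Q_x$ and $Q_y$ are two distinct points of $\tau_{P_\lambda}(U_{\alpha,\beta})$, and let $l_{x,y}$ be the line through them. If $T(\alpha x^2)\neq T(\alpha y^2)$, then $l_{x,y}\cap\tau_{P_\lambda}(U_{\alpha,\beta})=\{Q_x,Q_y\}$.
   Context: $GF(q^2)=\{a+\epsilon b: a,b\in GF(q)\}$ with $\epsilon^2=w\in GF(q)$, $\epsilon\notin GF(q)$. For $x\in GF(q^2)$ write $\overline{x}=x^q$, $T(x)=x+\overline{x}$, $N(x)=x\overline{x}$. Points of $PG(2,q^2)$ are written $[a,b,c]$ (homogeneous coordinates), lines $[x,y,z]^t$, and $[a,b,c]$ lies on $[x,y,z]^t$ iff $ax+by+cz=0$. $P_\infty=[0,1,0]$. The orthogonal-Buekenhout-Metz unital is $U_{\alpha,\beta}=\{[x,\alpha x^2+\beta N(x)+r,1]: x\in GF(q^2), r\in GF(q)\}\cup\{P_\infty\}$; every line meets it in $1$ point (tangent) or $q+1$ points (secant). For a point $P\notin U_{\alpha,\beta}$, the feet of $P$ are the $q+1$ points of contact with $U_{\alpha,\beta}$ of the tangent lines through $P$, and $\tau_P(U_{\alpha,\beta})$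 denotes the set of feet of $P$. -}

module Defs where

open import Data.Nat using (ℕ; zero; suc)
open import Data.Fin using (Fin)
open import Data.Product using (Σ; _×_; _,_)
open import Data.Sum using (_⊎_)
open import Relation.Binary.PropositionalEquality using (_≡_; _≢_)
open import Relation.Nullary using (¬_)
open import Algebra.Structures using (IsCommutativeRing)
open import Function.Bundles using (_↔_)

record FiniteField : Set₁ where
  infixl 6 _+_
  infixl 7 _*_
  field
    Carrier : Set
    _+_ _*_ : Carrier → Carrier → Carrier
    -_ : Carrier → Carrier
    0# 1# : Carrier
    isCommutativeRing : IsCommutativeRing _≡_ _+_ _*_ -_ 0# 1#
    0≢1 : 0# ≢ 1#
    inverse : ∀ x → x ≢ 0# → Σ Carrier (λ y → x * y ≡ 1#)
    size : ℕ
    enumeration : Fin size ↔ Carrier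

-- GF(q^2) = { a + ε b : a, b ∈ GF(q) } with ε² = w, represented as pairs (a , b).
module GF2 (F : FiniteField) (w : FiniteField.Carrier F) where
  open FiniteField F

  GF : Set
  GF = Carrier × Carrier

  emb : Carrier → GF
  emb a = (a , 0#)

  ε : GF
  ε = (0# , 1#)

  𝟘 𝟙 : GF
  𝟘 = emb 0#
  𝟙 = emb 1#

  infixl 6 _⊕_ _⊝_
  infixl 7 _⊗_
  infixr 8 _^_

  _⊕_ : GF → GF → GF
  (a , b) ⊕ (c , d) = (a + c , b + d)

  _⊗_ : GF → GF → GF
  (a , b) ⊗ (c , d) = (a * c + w * (b * d) , a * d + b * c)

  ⊖_ : GF → GF
  ⊖ (a , b) = (- a , - b)

  _⊝_ : GF → GF → GF
  x ⊝ y = x ⊕ (⊖ y)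

  _^_ : GF → ℕ → GF
  x ^ zero = 𝟙
  x ^ suc k = x ⊗ (x ^ k)

  conj : GF → GF
  conj x = x ^ size

  T N : GF → GF
  T x = x ⊕ conj x
  N x = x ⊗ conj x

  -- homogeneous coordinate triples (points and lines of PG(2,q^2))
  Triple : Set
  Triple = GF × GF × GF

  scale : GF → Triple → Triple
  scale k (a , b , c) = (k ⊗ a , k ⊗ b , k ⊗ c)

  _∼_ : Triple → Triple → Set
  u ∼ v = Σ GF (λ k → (k ≢ 𝟘) × (v ≡ scale k u))

  dot : Triple → Triple → GF
  dot (a , b , c) (x , y , z) = a ⊗ x ⊕ b ⊗ y ⊕ c ⊗ z

  -- line through two points (cross product of coordinates)
  cross : Triple → Triple → Triple
  cross (a , b , c) (x , y , z) = (b ⊗ z ⊝ c ⊗ y , c ⊗ x ⊝ a ⊗ z , a ⊗ y ⊝ b ⊗ x)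

  Incident : Triple → Triple → Set
  Incident P L = dot P L ≡ 𝟘

  P∞ : Triple
  P∞ = (𝟘 , 𝟙 , 𝟘)

  InU : GF → GF → Triple → Set
  InU α β P = (P∞ ∼ P) ⊎ Σ GF (λ x → Σ Carrier (λ r →
                 (x , α ⊗ x ⊗ x ⊕ β ⊗ N x ⊕ emb r , 𝟙) ∼ P))

  -- Q is a foot of P (P ∉ U): Q ∈ U and the line PQ is tangent to U,
  -- i.e. meets U only in Q.
  Foot : GF → GF → Triple → Triple → Set
  Foot α β P Q = ¬ InU α β P × InU α β Q ×
                 (∀ R → InU α β R → Incident R (cross P Q) → Q ∼ R)

  Pλ : Carrier → Triple
  Pλ l = (𝟘 , emb l ⊗ ε , 𝟙)

  Qz : GF → Carrier → GF → Triple
  Qz α l z = (z , T (α ⊗ z ⊗ z) ⊝ emb l ⊗ ε , 𝟙)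

-- The line joining P_λ to a point R = [z, Y, 1] of U contains [tz, λε + t(Y − λε), 1], which lies on U iff an
-- imaginary part vanishes; for t = 1 + μd (μ ∈ GF(q), d ∈ GF(q)²) this reads μ(L(d) + μQ(d)) = 0 with Q a non-zero
-- quadratic form. So the line is tangent iff the linear form L vanishes, i.e. iff R = Q_z with
-- Im(αz²) + Im(β)N(z) + λ = 0. Here N and T are computed from x̄ = a − εb for x = a + εb, which follows from the
-- Frobenius identity and Fermat (x̄ = x would give X^q − X the q + 1 roots GF(q) ∪ {ε}).
-- If Q_z lies on the chord Q_xQ_y, comparing first coordinates with the values of T(α·²) gives z = x + μ(y − x)
-- with μ ∈ GF(q), as T(αx²) ≠ T(αy²). Re(αv²) and the foot condition are quadratic in v and agree with their
-- linear interpolation at μ = 0, 1, so (μ² − μ)Re(αd²) = 0 = (μ² − μ)(Im(αd²) + Im(β)N(d)) with d = y − x.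
-- For μ² ≠ μ this makes 4N(α) + (β̄ − β)² = 4(N(α) + w Im(β)²) zero, a square; hence μ ∈ {0, 1}.

module Submission where

open import Algebra.Bundles using (CommutativeRing; CommutativeSemiring)
open import Algebra.Structures using (IsCommutativeRing)
open import Data.Nat as ℕ using (ℕ)
open import Data.Nat.Primality using (Prime)
open import Data.Product using (Σ)
open import Relation.Binary.Definitions using (DecidableEquality)
open import Relation.Binary.PropositionalEquality as ≡ using (_≡_; _≢_)
open import Defs using (FiniteField; module GF2)

module IntegerRingSolver {r₁ r₂} (R : CommutativeRing r₁ r₂) where
  open import Algebra.Solver.Ring.AlmostCommutativeRing using (_-Raw-AlmostCommutative⟶_; fromCommutativeRing)
  open import Data.Integer as ℤ using (ℤ; +_; -[1+_]; _⊖_)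
  import Data.Integer.Properties as ℤₚ
  import Data.Integer.Tactic.RingSolver as ℤ-Solver
  open import Data.Maybe using (Maybe; just; nothing)
  open import Data.Nat using (zero; suc)
  open import Relation.Nullary using (yes; no)
  open CommutativeRing R
  open import Algebra.Properties.Semiring.Mult.TCOptimised semiring using (_×_; ×-homo-+; ×1-homo-*)
  open import Algebra.Properties.Ring ring using (-‿distribˡ-*; -‿distribʳ-*; -‿involutive; -0#≈0#)
  open import Algebra.Properties.AbelianGroup +-abelianGroup using (⁻¹-∙-comm)
  open import Relation.Binary.Reasoning.Setoid setoid
  import Algebra.Solver.CommutativeMonoid +-commutativeMonoid as +-Solver

  -- _×_ is the type-checking-optimised multiple, for which 0 × 1# and 1 × 1# are 0# and 1# on the nose,
  -- so that the constants of solved identities are the ring's own 0# and 1#.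
  fromℤ : ℤ → Carrier
  fromℤ (+ n) = n × 1#
  fromℤ -[1+ n ] = - (suc n × 1#)

  private
    positivePart negativePart : ℤ → ℕ
    positivePart (+ n) = n
    positivePart -[1+ n ] = 0
    negativePart (+ n) = 0
    negativePart -[1+ n ] = suc n

    i≡positivePart⊖negativePart : ∀ i → i ≡ positivePart i ⊖ negativePart i
    i≡positivePart⊖negativePart (+ zero) = ≡.refl
    i≡positivePart⊖negativePart (+ suc n) = ≡.refl
    i≡positivePart⊖negativePart -[1+ n ] = ≡.refl

    swap-middle : ∀ a b c d → (a + b) + (c + d) ≈ (a + c) + (b + d)
    swap-middle = +-Solver.solve 4 (λ a b c d → (a +-Solver.⊕ b) +-Solver.⊕ (c +-Solver.⊕ d) +-Solver.⊜ (a +-Solver.⊕ c) +-Solver.⊕ (b +-Solver.⊕ d)) refl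

    [a+b]-[c+d]≈[a-c]+[b-d] : ∀ a b c d → (a + b) - (c + d) ≈ (a - c) + (b - d)
    [a+b]-[c+d]≈[a-c]+[b-d] a b c d = trans (+-congˡ (sym (⁻¹-∙-comm c d))) (swap-middle a b (- c) (- d))

    fromℤ-⊖ : ∀ m n → fromℤ (m ⊖ n) ≈ m × 1# - n × 1#
    fromℤ-⊖ zero zero = sym (-‿inverseʳ 0#)
    fromℤ-⊖ (suc m) zero = sym (trans (+-congˡ -0#≈0#) (+-identityʳ _))
    fromℤ-⊖ zero (suc n) = sym (+-identityˡ _)
    fromℤ-⊖ (suc m) (suc n) = begin
      fromℤ (suc m ⊖ suc n)                    ≡⟨ ≡.cong fromℤ (ℤₚ.[1+m]⊖[1+n]≡m⊖n m n) ⟩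
      fromℤ (m ⊖ n)                            ≈⟨ fromℤ-⊖ m n ⟩
      m × 1# - n × 1#                      ≈⟨ +-identityˡ _ ⟨
      0# + (m × 1# - n × 1#)               ≈⟨ +-congʳ (-‿inverseʳ 1#) ⟨
      (1# - 1#) + (m × 1# - n × 1#)        ≈⟨ [a+b]-[c+d]≈[a-c]+[b-d] 1# (m × 1#) 1# (n × 1#) ⟨
      (1# + m × 1#) - (1# + n × 1#)        ≈⟨ +-cong (×-homo-+ 1# 1 m) (-‿cong (×-homo-+ 1# 1 n)) ⟨
      suc m × 1# - suc n × 1#              ∎

    fromℤ-as-difference : ∀ i → fromℤ i ≈ positivePart i × 1# - negativePart i × 1#
    fromℤ-as-difference i = trans (reflexive (≡.cong fromℤ (i≡positivePart⊖negativePart i))) (fromℤ-⊖ (positivePart i) (negativePart i))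

    ⊖-+-⊖ : ∀ a b c d → (a ⊖ b) ℤ.+ (c ⊖ d) ≡ (a ℕ.+ c) ⊖ (b ℕ.+ d)
    ⊖-+-⊖ a b c d =
      ≡.trans (≡.cong₂ ℤ._+_ (≡.sym (ℤₚ.[+m]-[+n]≡m⊖n a b)) (≡.sym (ℤₚ.[+m]-[+n]≡m⊖n c d)))
        (≡.trans (lemma (+ a) (+ b) (+ c) (+ d)) (ℤₚ.[+m]-[+n]≡m⊖n (a ℕ.+ c) (b ℕ.+ d)))
      where
      lemma : ∀ x y z u → (x ℤ.- y) ℤ.+ (z ℤ.- u) ≡ (x ℤ.+ z) ℤ.- (y ℤ.+ u)
      lemma = ℤ-Solver.solve-∀

    ⊖-*-⊖ : ∀ a b c d → (a ⊖ b) ℤ.* (c ⊖ d) ≡ (a ℕ.* c ℕ.+ b ℕ.* d) ⊖ (a ℕ.* d ℕ.+ b ℕ.* c)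
    ⊖-*-⊖ a b c d =
      ≡.trans (≡.cong₂ ℤ._*_ (≡.sym (ℤₚ.[+m]-[+n]≡m⊖n a b)) (≡.sym (ℤₚ.[+m]-[+n]≡m⊖n c d)))
        (≡.trans (lemma (+ a) (+ b) (+ c) (+ d))
          (≡.trans (≡.cong₂ ℤ._-_ (+-of-* a c b d) (+-of-* a d b c)) (ℤₚ.[+m]-[+n]≡m⊖n (a ℕ.* c ℕ.+ b ℕ.* d) (a ℕ.* d ℕ.+ b ℕ.* c))))
      where
      lemma : ∀ x y z u → (x ℤ.- y) ℤ.* (z ℤ.- u) ≡ (x ℤ.* z ℤ.+ y ℤ.* u) ℤ.- (x ℤ.* u ℤ.+ y ℤ.* z)
      lemma = ℤ-Solver.solve-∀
      +-of-* : ∀ m n k l → + m ℤ.* + n ℤ.+ + k ℤ.* + l ≡ + (m ℕ.* n ℕ.+ k ℕ.* l)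
      +-of-* m n k l = ≡.sym (≡.trans (ℤₚ.pos-+ (m ℕ.* n) (k ℕ.* l)) (≡.cong₂ ℤ._+_ (ℤₚ.pos-* m n) (ℤₚ.pos-* k l)))

    [a-b]*[c-d]≈[ac+bd]-[ad+bc] : ∀ a b c d → (a - b) * (c - d) ≈ (a * c + b * d) - (a * d + b * c)
    [a-b]*[c-d]≈[ac+bd]-[ad+bc] a b c d = begin
      (a - b) * (c - d)                          ≈⟨ distribʳ (c - d) a (- b) ⟩
      a * (c - d) + - b * (c - d)                ≈⟨ +-cong (distribˡ a c (- d)) (distribˡ (- b) c (- d)) ⟩
      (a * c + a * - d) + (- b * c + - b * - d)  ≈⟨ +-cong (+-congˡ (sym (-‿distribʳ-* a d))) (+-cong (sym (-‿distribˡ-* b c)) neg*neg) ⟩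
      (a * c - a * d) + (- (b * c) + b * d)      ≈⟨ +-congˡ (+-comm _ _) ⟩
      (a * c - a * d) + (b * d - b * c)          ≈⟨ swap-middle (a * c) (- (a * d)) (b * d) (- (b * c)) ⟩
      (a * c + b * d) + (- (a * d) - b * c)      ≈⟨ +-congˡ (⁻¹-∙-comm _ _) ⟩
      (a * c + b * d) - (a * d + b * c)          ∎
      where
      neg*neg : - b * - d ≈ b * d
      neg*neg = trans (sym (-‿distribˡ-* b (- d))) (trans (-‿cong (sym (-‿distribʳ-* b d))) (-‿involutive _))

    fromℤ-homo-+ : ∀ i j → fromℤ (i ℤ.+ j) ≈ fromℤ i + fromℤ j
    fromℤ-homo-+ i j = begin
      fromℤ (i ℤ.+ j)                           ≡⟨ ≡.cong fromℤ (≡.trans (≡.cong₂ ℤ._+_ (i≡positivePart⊖negativePart i) (i≡positivePart⊖negativePart j)) (⊖-+-⊖ a b c d)) ⟩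
      fromℤ ((a ℕ.+ c) ⊖ (b ℕ.+ d))             ≈⟨ fromℤ-⊖ (a ℕ.+ c) (b ℕ.+ d) ⟩
      (a ℕ.+ c) × 1# - (b ℕ.+ d) × 1#       ≈⟨ +-cong (×-homo-+ 1# a c) (-‿cong (×-homo-+ 1# b d)) ⟩
      (a × 1# + c × 1#) - (b × 1# + d × 1#) ≈⟨ [a+b]-[c+d]≈[a-c]+[b-d] _ _ _ _ ⟩
      (a × 1# - b × 1#) + (c × 1# - d × 1#) ≈⟨ +-cong (fromℤ-as-difference i) (fromℤ-as-difference j) ⟨
      fromℤ i + fromℤ j                         ∎
      where a = positivePart i; b = negativePart i; c = positivePart j; d = negativePart j

    fromℤ-homo-* : ∀ i j → fromℤ (i ℤ.* j) ≈ fromℤ i * fromℤ j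
    fromℤ-homo-* i j = begin
      fromℤ (i ℤ.* j)                                                 ≡⟨ ≡.cong fromℤ (≡.trans (≡.cong₂ ℤ._*_ (i≡positivePart⊖negativePart i) (i≡positivePart⊖negativePart j)) (⊖-*-⊖ a b c d)) ⟩
      fromℤ ((a ℕ.* c ℕ.+ b ℕ.* d) ⊖ (a ℕ.* d ℕ.+ b ℕ.* c))           ≈⟨ fromℤ-⊖ (a ℕ.* c ℕ.+ b ℕ.* d) (a ℕ.* d ℕ.+ b ℕ.* c) ⟩
      (a ℕ.* c ℕ.+ b ℕ.* d) × 1# - (a ℕ.* d ℕ.+ b ℕ.* c) × 1#     ≈⟨ +-cong (×-sum-of-products a c b d) (-‿cong (×-sum-of-products a d b c)) ⟩
      (ι a * ι c + ι b * ι d) - (ι a * ι d + ι b * ι c)           ≈⟨ [a-b]*[c-d]≈[ac+bd]-[ad+bc] _ _ _ _ ⟨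
      (ι a - ι b) * (ι c - ι d)                                   ≈⟨ *-cong (fromℤ-as-difference i) (fromℤ-as-difference j) ⟨
      fromℤ i * fromℤ j                                               ∎
      where
      a = positivePart i; b = negativePart i; c = positivePart j; d = negativePart j
      ι : ℕ → Carrier
      ι n = n × 1#
      ×-sum-of-products : ∀ m n k l → (m ℕ.* n ℕ.+ k ℕ.* l) × 1# ≈ ι m * ι n + ι k * ι l
      ×-sum-of-products m n k l = trans (×-homo-+ 1# (m ℕ.* n) (k ℕ.* l)) (+-cong (×1-homo-* m n) (×1-homo-* k l))

    fromℤ-homo-neg : ∀ i → fromℤ (ℤ.- i) ≈ - fromℤ i
    fromℤ-homo-neg i = begin
      fromℤ (ℤ.- i)                    ≡⟨ ≡.cong fromℤ (≡.trans (≡.cong ℤ.-_ (i≡positivePart⊖negativePart i)) (≡.sym (ℤₚ.⊖-swap b a))) ⟩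
      fromℤ (b ⊖ a)                    ≈⟨ fromℤ-⊖ b a ⟩
      b × 1# - a × 1#              ≈⟨ +-comm _ _ ⟩
      - (a × 1#) + b × 1#          ≈⟨ +-congˡ (-‿involutive _) ⟨
      - (a × 1#) - - (b × 1#)      ≈⟨ ⁻¹-∙-comm _ _ ⟩
      - (a × 1# - b × 1#)          ≈⟨ -‿cong (fromℤ-as-difference i) ⟨
      - fromℤ i                      ∎
      where a = positivePart i; b = negativePart i

  ℤ⟶R : ℤ.+-*-rawRing -Raw-AlmostCommutative⟶ fromCommutativeRing R
  ℤ⟶R = record
    { ⟦_⟧ = fromℤ
    ; +-homo = fromℤ-homo-+
    ; *-homo = fromℤ-homo-*
    ; -‿homo = fromℤ-homo-neg
    ; 0-homo = refl
    ; 1-homo = refl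
    }

  fromℤ-≟ : ∀ i j → Maybe (fromℤ i ≈ fromℤ j)
  fromℤ-≟ i j with i ℤ.≟ j
  ... | yes ≡.refl = just refl
  ... | no _ = nothing

  open import Algebra.Solver.Ring ℤ.+-*-rawRing (fromCommutativeRing R) ℤ⟶R fromℤ-≟ public

  :0 :1 : ∀ {n} → Polynomial n
  :0 = con (+ 0)
  :1 = con (+ 1)

module PrimeBinomialCoefficients where
  open import Data.Nat
  open import Data.Nat.Properties
  open import Data.Nat.Divisibility
  open import Data.Nat.DivMod using (m/n*n≡m)
  open import Data.Nat.Primality using (Prime; euclidsLemma; ¬prime[1])
  open import Data.Nat.Combinatorics using (_C_; nCk≡n!/k![n-k]!; k![n∸k]!∣n!)
  open import Data.Sum using (inj₁; inj₂)
  open import Data.Empty using (⊥-elim)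
  open import Relation.Nullary using (¬_)
  open import Relation.Binary.PropositionalEquality using (refl; cong; trans; subst; sym)

  prime∤m! : ∀ {p} → Prime p → ∀ m → m < p → ¬ (p ∣ m !)
  prime∤m! p-prime zero _ p∣1 with ∣1⇒≡1 p∣1
  ... | refl = ¬prime[1] p-prime
  prime∤m! p-prime (suc m) m<p p∣m! with euclidsLemma (suc m) (m !) p-prime p∣m!
  ... | inj₁ p∣1+m = <⇒≱ m<p (∣⇒≤ p∣1+m)
  ... | inj₂ p∣m = prime∤m! p-prime m (<-trans (n<1+n m) m<p) p∣m

  prime∣pCk : ∀ {p k} → Prime p → 0 < k → k < p → p ∣ p C k
  prime∣pCk {p} {k} p-prime 0<k k<p with euclidsLemma (p C k) (k ! * (p ∸ k) !) p-prime p∣product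
    where
    instance _ = k !* (p ∸ k) !≢0
    p∣product : p ∣ (p C k) * (k ! * (p ∸ k) !)
    p∣product = subst (p ∣_) (sym (trans (cong (_* (k ! * (p ∸ k) !)) (nCk≡n!/k![n-k]! (<⇒≤ k<p))) (m/n*n≡m (k![n∸k]!∣n! (<⇒≤ k<p)))))
      (p∣p! p (<-≤-trans 0<k (<⇒≤ k<p)))
      where
      p∣p! : ∀ n → 0 < n → n ∣ n !
      p∣p! (suc n) _ = m∣m*n (n !)
  ... | inj₁ p∣pCk = p∣pCk
  ... | inj₂ p∣k!*[p-k]! with euclidsLemma (k !) ((p ∸ k) !) p-prime p∣k!*[p-k]!
  ... | inj₁ p∣k! = ⊥-elim (prime∤m! p-prime k k<p p∣k!)
  ... | inj₂ p∣[p-k]! = ⊥-elim (prime∤m! p-prime (p ∸ k) (∸-monoʳ-< 0<k (<⇒≤ k<p)) p∣[p-k]!)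

module Frobenius {a ℓ} (R : CommutativeSemiring a ℓ) where
  open import Data.Nat using (ℕ; zero; suc; z≤n; s≤s)
  import Data.Nat.Properties as ℕₚ
  open import Data.Nat.Divisibility using (_∣_; divides)
  open import Data.Nat.Combinatorics using (_C_; nCn≡1; nCk≡nC[n∸k])
  open import Data.Fin using (Fin; zero; suc; toℕ; inject₁; fromℕ)
  import Data.Fin.Properties as Finₚ

  open PrimeBinomialCoefficients using (prime∣pCk)

  open CommutativeSemiring R hiding (zero)
  open import Algebra.Properties.Semiring.Mult semiring using (_×_; ×-congʳ; ×-homo-1; ×-assoc-*; ×1-homo-*)
  open import Algebra.Properties.Semiring.Sum semiring using (sum; sum-init-last; sum-cong-≋; sum-replicate-zero)
  open import Algebra.Properties.Semiring.Exp semiring using (_^_; ^-congˡ; ^-assocʳ)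
  open import Algebra.Properties.CommutativeSemiring.Binomial R using (theorem; binomialTerm)
  open import Relation.Binary.Reasoning.Setoid setoid

  multiple-of-p×x≈0 : ∀ {p m} → p × 1# ≈ 0# → p ∣ m → ∀ x → m × x ≈ 0#
  multiple-of-p×x≈0 {p} p×1≈0 (divides c ≡.refl) x = begin
    (c ℕ.* p) × x                  ≈⟨ ×-congʳ (c ℕ.* p) (*-identityˡ x) ⟨
    (c ℕ.* p) × (1# * x)           ≈⟨ ×-assoc-* (c ℕ.* p) 1# x ⟨
    ((c ℕ.* p) × 1#) * x           ≈⟨ *-congʳ (×1-homo-* c p) ⟩
    ((c × 1#) * (p × 1#)) * x      ≈⟨ *-congʳ (*-congˡ p×1≈0) ⟩
    ((c × 1#) * 0#) * x            ≈⟨ *-congʳ (zeroʳ _) ⟩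
    0# * x                         ≈⟨ zeroˡ x ⟩
    0#                             ∎

  frobenius : ∀ {p} → Prime p → p × 1# ≈ 0# → ∀ x y → (x + y) ^ p ≈ x ^ p + y ^ p
  frobenius {suc r} p-prime p×1≈0 x y = begin
    (x + y) ^ p                                         ≈⟨ theorem p x y ⟩
    term zero + sum (λ j → term (suc j))                ≈⟨ +-congˡ (sum-init-last (λ j → term (suc j))) ⟩
    term zero + (sum middle + term (suc (fromℕ r)))     ≈⟨ +-cong first (+-cong middle≈0 last) ⟩
    y ^ p + (0# + x ^ p)                                ≈⟨ +-comm _ _ ⟩
    (0# + x ^ p) + y ^ p                                ≈⟨ +-congʳ (+-identityˡ _) ⟩
    x ^ p + y ^ p                                       ∎
    where
    p = suc r
    term : Fin (suc p) → Carrier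
    term = binomialTerm x y p
    middle : Fin r → Carrier
    middle j = term (suc (inject₁ j))
    middle≈0 : sum middle ≈ 0#
    middle≈0 = trans (sum-cong-≋ {r} (λ j → multiple-of-p×x≈0 p×1≈0 (prime∣pCk p-prime (s≤s z≤n) (s≤s (j<r j))) _)) (sum-replicate-zero r)
      where
      j<r : ∀ j → toℕ (inject₁ j) ℕ.< r
      j<r j = ≡.subst (ℕ._< r) (≡.sym (Finₚ.toℕ-inject₁ j)) (Finₚ.toℕ<n j)
    first : term zero ≈ y ^ p
    first = begin
      (p C 0) × (1# * y ^ p)     ≡⟨ ≡.cong (_× (1# * y ^ p)) (≡.trans (nCk≡nC[n∸k] {k = 0} {n = p} z≤n) (nCn≡1 p)) ⟩
      1 × (1# * y ^ p)           ≈⟨ ×-homo-1 _ ⟩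
      1# * y ^ p                 ≈⟨ *-identityˡ _ ⟩
      y ^ p                      ∎
    last : term (suc (fromℕ r)) ≈ x ^ p
    last = begin
      term (suc (fromℕ r))                        ≡⟨ ≡.cong (λ k → (p C suc k) × (x ^ suc k * y ^ (p ℕ.∸ suc k))) (Finₚ.toℕ-fromℕ r) ⟩
      (p C p) × (x ^ p * y ^ (p ℕ.∸ p))           ≡⟨ ≡.cong₂ (λ c e → c × (x ^ p * y ^ e)) (nCn≡1 p) (ℕₚ.n∸n≡0 p) ⟩
      1 × (x ^ p * 1#)                            ≈⟨ ×-homo-1 _ ⟩
      x ^ p * 1#                                  ≈⟨ *-identityʳ _ ⟩
      x ^ p                                       ∎

  frobenius-^ : ∀ {p} → Prime p → p × 1# ≈ 0# → ∀ k x y → (x + y) ^ (p ℕ.^ k) ≈ x ^ (p ℕ.^ k) + y ^ (p ℕ.^ k)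
  frobenius-^ p-prime p×1≈0 zero x y = distribʳ 1# x y
  frobenius-^ {p} p-prime p×1≈0 (suc k) x y = begin
    (x + y) ^ (p ℕ.* p ℕ.^ k)                    ≈⟨ ^-assocʳ (x + y) p (p ℕ.^ k) ⟨
    ((x + y) ^ p) ^ (p ℕ.^ k)                    ≈⟨ ^-congˡ (p ℕ.^ k) (frobenius p-prime p×1≈0 x y) ⟩
    (x ^ p + y ^ p) ^ (p ℕ.^ k)                  ≈⟨ frobenius-^ p-prime p×1≈0 k (x ^ p) (y ^ p) ⟩
    (x ^ p) ^ (p ℕ.^ k) + (y ^ p) ^ (p ℕ.^ k)    ≈⟨ +-cong (^-assocʳ x p (p ℕ.^ k)) (^-assocʳ y p (p ℕ.^ k)) ⟩
    x ^ (p ℕ.* p ℕ.^ k) + y ^ (p ℕ.* p ℕ.^ k)    ∎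

module FieldProperties {A : Set} {plus times : A → A → A} {negate : A → A} {zeroᴿ oneᴿ : A}
  (isCommutativeRing : IsCommutativeRing _≡_ plus times negate zeroᴿ oneᴿ)
  (_≟_ : DecidableEquality A)
  (inverse : ∀ x → x ≢ zeroᴿ → Σ A λ y → times x y ≡ oneᴿ)
  (1≢0 : oneᴿ ≢ zeroᴿ)
  where
  open import Data.Product using (_×_; _,_; proj₁; proj₂)
  open import Level using (0ℓ)
  open import Data.Nat using (zero; suc)
  open import Data.Fin using (Fin; zero; suc)
  import Data.Fin.Properties as Finₚ
  open import Data.Vec using (Vec; []; _∷_)
  open import Data.Sum using (_⊎_; inj₁; inj₂; [_,_]′)
  open import Data.Empty using (⊥-elim)
  open import Function.Definitions using (Injective)
  open import Relation.Nullary using (¬_; yes; no)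
  open ≡.≡-Reasoning

  commutativeRing : CommutativeRing 0ℓ 0ℓ
  commutativeRing = record { isCommutativeRing = isCommutativeRing }

  open CommutativeRing commutativeRing hiding (zero)

  open IntegerRingSolver commutativeRing using (solve; _:+_; _:*_; _:-_; :-_; :0; :1; _:=_)

  x-y≡0⇒x≡y : ∀ {x y} → x - y ≡ 0# → x ≡ y
  x-y≡0⇒x≡y {x} {y} x-y≡0 = begin
    x              ≡⟨ solve 2 (λ x y → x := (x :- y) :+ y) ≡.refl x y ⟩
    (x - y) + y    ≡⟨ ≡.cong (_+ y) x-y≡0 ⟩
    0# + y         ≡⟨ +-identityˡ y ⟩
    y              ∎

  x≡y+[x-y] : ∀ x y → x ≡ y + (x - y)
  x≡y+[x-y] = solve 2 (λ x y → x := y :+ (x :- y)) ≡.refl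

  [x-z]-[y-z]≡x-y : ∀ x y z → (x - z) - (y - z) ≡ x - y
  [x-z]-[y-z]≡x-y = solve 3 (λ x y z → (x :- z) :- (y :- z) := x :- y) ≡.refl

  -x≡0⇒x≡0 : ∀ {x} → - x ≡ 0# → x ≡ 0#
  -x≡0⇒x≡0 {x} -x≡0 = begin
    x        ≡⟨ solve 1 (λ x → x := :- (:- x)) ≡.refl x ⟩
    - (- x)  ≡⟨ ≡.cong -_ -x≡0 ⟩
    - 0#     ≡⟨ solve 0 (:- :0 := :0) ≡.refl ⟩
    0#       ∎

  x*y≡0⇒x≡0∨y≡0 : ∀ x y → x * y ≡ 0# → x ≡ 0# ⊎ y ≡ 0#
  x*y≡0⇒x≡0∨y≡0 x y xy≡0 with x ≟ 0#
  ... | yes x≡0 = inj₁ x≡0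
  ... | no x≢0 with inverse x x≢0
  ... | x⁻¹ , xx⁻¹≡1 = inj₂ (begin
    y                  ≡⟨ solve 3 (λ x x⁻¹ y → y := (x :* x⁻¹) :* y :+ (:1 :- x :* x⁻¹) :* y) ≡.refl x x⁻¹ y ⟩
    (x * x⁻¹) * y + (1# - x * x⁻¹) * y    ≡⟨ ≡.cong (λ t → (x * x⁻¹) * y + (1# - t) * y) xx⁻¹≡1 ⟩
    (x * x⁻¹) * y + (1# - 1#) * y         ≡⟨ solve 3 (λ x x⁻¹ y → (x :* x⁻¹) :* y :+ (:1 :- :1) :* y := x⁻¹ :* (x :* y)) ≡.refl x x⁻¹ y ⟩
    x⁻¹ * (x * y)                         ≡⟨ ≡.cong (x⁻¹ *_) xy≡0 ⟩
    x⁻¹ * 0#                              ≡⟨ zeroʳ x⁻¹ ⟩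
    0#                                    ∎)

  x≢0⇒x*y≡0⇒y≡0 : ∀ {x y} → x ≢ 0# → x * y ≡ 0# → y ≡ 0#
  x≢0⇒x*y≡0⇒y≡0 x≢0 xy≡0 = [ (λ x≡0 → ⊥-elim (x≢0 x≡0)) , (λ y≡0 → y≡0) ]′ (x*y≡0⇒x≡0∨y≡0 _ _ xy≡0)

  *-cancelˡ : ∀ {x y z} → x ≢ 0# → x * y ≡ x * z → y ≡ z
  *-cancelˡ {x} {y} {z} x≢0 xy≡xz = x-y≡0⇒x≡y (x≢0⇒x*y≡0⇒y≡0 x≢0 (begin
    x * (y - z)      ≡⟨ solve 3 (λ x y z → x :* (y :- z) := x :* y :- x :* z) ≡.refl x y z ⟩
    x * y - x * z    ≡⟨ ≡.cong (_- x * z) xy≡xz ⟩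
    x * z - x * z    ≡⟨ -‿inverseʳ (x * z) ⟩
    0#               ∎))

  *-≢0 : ∀ {x y} → x ≢ 0# → y ≢ 0# → x * y ≢ 0#
  *-≢0 x≢0 y≢0 xy≡0 = y≢0 (x≢0⇒x*y≡0⇒y≡0 x≢0 xy≡0)

  x*x≡y*y⇒x≡y∨x≡-y : ∀ x y → x * x ≡ y * y → x ≡ y ⊎ x ≡ - y
  x*x≡y*y⇒x≡y∨x≡-y x y xx≡yy = [ (λ h → inj₁ (x-y≡0⇒x≡y h)) , (λ h → inj₂ (x-y≡0⇒x≡y (≡.trans (≡.cong (λ t → x + t) (-‿involutive y)) h))) ]′
    (x*y≡0⇒x≡0∨y≡0 (x - y) (x + y) (begin
      (x - y) * (x + y)   ≡⟨ solve 2 (λ x y → (x :- y) :* (x :+ y) := x :* x :- y :* y) ≡.refl x y ⟩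
      x * x - y * y       ≡⟨ ≡.cong (_- y * y) xx≡yy ⟩
      y * y - y * y       ≡⟨ -‿inverseʳ (y * y) ⟩
      0#                  ∎))
    where
    -‿involutive : ∀ y → - (- y) ≡ y
    -‿involutive = solve 1 (λ y → :- (:- y) := y) ≡.refl

  -- A monic polynomial of degree m is given by its m lower coefficients, constant term first.
  evalMonic : ∀ {m} → Vec A m → A → A
  evalMonic [] x = 1#
  evalMonic (c ∷ cs) x = c + x * evalMonic cs x

  divideByRoot : ∀ {m} → A → Vec A (suc m) → Vec A m
  divideByRoot r (c ∷ []) = []
  divideByRoot r (c ∷ d ∷ ds) = evalMonic (d ∷ ds) r ∷ divideByRoot r (d ∷ ds)

  evalMonic-divideByRoot : ∀ {m} r (f : Vec A (suc m)) x →
    evalMonic f x ≡ (x - r) * evalMonic (divideByRoot r f) x + evalMonic f r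
  evalMonic-divideByRoot r (c ∷ []) x = solve 3 (λ c x r → c :+ x :* :1 := (x :- r) :* :1 :+ (c :+ r :* :1)) ≡.refl c x r
  evalMonic-divideByRoot r (c ∷ d ∷ ds) x = begin
    c + x * evalMonic (d ∷ ds) x                      ≡⟨ ≡.cong (λ t → c + x * t) (evalMonic-divideByRoot r (d ∷ ds) x) ⟩
    c + x * ((x - r) * evalMonic q x + e)             ≡⟨ solve 5 (λ c x r Q e → c :+ x :* ((x :- r) :* Q :+ e) := (x :- r) :* (e :+ x :* Q) :+ (c :+ r :* e)) ≡.refl c x r (evalMonic q x) e ⟩
    (x - r) * (e + x * evalMonic q x) + (c + r * e)   ∎
    where
    q = divideByRoot r (d ∷ ds)
    e = evalMonic (d ∷ ds) r

  monic-roots<degree : ∀ m (f : Vec A m) (ρ : Fin (suc m) → A) → Injective _≡_ _≡_ ρ → ¬ (∀ i → evalMonic f (ρ i) ≡ 0#)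
  monic-roots<degree zero [] ρ ρ-injective roots = 1≢0 (roots zero)
  monic-roots<degree (suc m) f ρ ρ-injective roots =
    monic-roots<degree m (divideByRoot r f) (λ i → ρ (suc i)) (λ eq → Finₚ.suc-injective (ρ-injective eq)) quotient-roots
    where
    r = ρ zero
    quotient-roots : ∀ i → evalMonic (divideByRoot r f) (ρ (suc i)) ≡ 0#
    quotient-roots i = x≢0⇒x*y≡0⇒y≡0 x-r≢0 (begin
      (x - r) * evalMonic q x                  ≡⟨ +-identityʳ _ ⟨
      (x - r) * evalMonic q x + 0#             ≡⟨ ≡.cong (λ t → (x - r) * evalMonic q x + t) (roots zero) ⟨
      (x - r) * evalMonic q x + evalMonic f r  ≡⟨ evalMonic-divideByRoot r f x ⟨
      evalMonic f x                            ≡⟨ roots (suc i) ⟩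
      0#                                       ∎)
      where
      x = ρ (suc i)
      q = divideByRoot r f
      x-r≢0 : x - r ≢ 0#
      x-r≢0 h with ρ-injective (x-y≡0⇒x≡y h)
      ... | ()

  module _ (1+1≢0 : 1# + 1# ≢ 0#) where

    x+x≡0⇒x≡0 : ∀ {x} → x + x ≡ 0# → x ≡ 0#
    x+x≡0⇒x≡0 {x} x+x≡0 = x≢0⇒x*y≡0⇒y≡0 1+1≢0 (≡.trans (solve 1 (λ x → (:1 :+ :1) :* x := x :+ x) ≡.refl x) x+x≡0)

    module BinaryForms (l₁ l₂ a b c : A) where

      linear quadratic : A × A → A
      linear (d₁ , d₂) = l₁ * d₁ + l₂ * d₂
      quadratic (d₁ , d₂) = a * (d₁ * d₁) + b * (d₁ * d₂) + c * (d₂ * d₂)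

      BothNonZeroAt : A × A → Set
      BothNonZeroAt d = linear d ≢ 0# × quadratic d ≢ 0#

      private
        e₁ e₂ e₊ e₋ : A × A
        e₁ = 1# , 0#
        e₂ = 0# , 1#
        e₊ = 1# , 1#
        e₋ = 1# , - 1#

        linear-e₁ : linear e₁ ≡ l₁
        linear-e₁ = solve 2 (λ l₁ l₂ → l₁ :* :1 :+ l₂ :* :0 := l₁) ≡.refl l₁ l₂
        linear-e₂ : linear e₂ ≡ l₂
        linear-e₂ = solve 2 (λ l₁ l₂ → l₁ :* :0 :+ l₂ :* :1 := l₂) ≡.refl l₁ l₂
        linear-e₊ : linear e₊ ≡ l₁ + l₂
        linear-e₊ = solve 2 (λ l₁ l₂ → l₁ :* :1 :+ l₂ :* :1 := l₁ :+ l₂) ≡.refl l₁ l₂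
        linear-e₋ : linear e₋ ≡ l₁ - l₂
        linear-e₋ = solve 2 (λ l₁ l₂ → l₁ :* :1 :+ l₂ :* (:- :1) := l₁ :- l₂) ≡.refl l₁ l₂
        quadratic-e₁ : quadratic e₁ ≡ a
        quadratic-e₁ = solve 3 (λ a b c → a :* (:1 :* :1) :+ b :* (:1 :* :0) :+ c :* (:0 :* :0) := a) ≡.refl a b c
        quadratic-e₂ : quadratic e₂ ≡ c
        quadratic-e₂ = solve 3 (λ a b c → a :* (:0 :* :0) :+ b :* (:0 :* :1) :+ c :* (:1 :* :1) := c) ≡.refl a b c
        quadratic-e₊ : quadratic e₊ ≡ a + b + c
        quadratic-e₊ = solve 3 (λ a b c → a :* (:1 :* :1) :+ b :* (:1 :* :1) :+ c :* (:1 :* :1) := a :+ b :+ c) ≡.refl a b c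
        quadratic-e₋ : quadratic e₋ ≡ a - b + c
        quadratic-e₋ = solve 3 (λ a b c → a :* (:1 :* :1) :+ b :* (:1 :* (:- :1)) :+ c :* ((:- :1) :* (:- :1)) := a :- b :+ c) ≡.refl a b c

        Zero : Set
        Zero = a ≡ 0# × b ≡ 0# × c ≡ 0#

        x+y≡0⇒x≡0⇒y≡0 : ∀ {x y} → x + y ≡ 0# → x ≡ 0# → y ≡ 0#
        x+y≡0⇒x≡0⇒y≡0 {x} {y} x+y≡0 x≡0 = ≡.trans (≡.sym (+-identityˡ y)) (≡.trans (≡.cong (_+ y) (≡.sym x≡0)) x+y≡0)

        zero-at-e₊e₋ : quadratic e₊ ≡ 0# → quadratic e₋ ≡ 0# → b ≡ 0# × a + c ≡ 0#
        zero-at-e₊e₋ Q₊ Q₋ =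
            x+x≡0⇒x≡0 (begin
              b + b                        ≡⟨ solve 3 (λ a b c → b :+ b := (a :+ b :+ c) :- (a :- b :+ c)) ≡.refl a b c ⟩
              (a + b + c) - (a - b + c)    ≡⟨ ≡.cong₂ _-_ (≡.trans (≡.sym quadratic-e₊) Q₊) (≡.trans (≡.sym quadratic-e₋) Q₋) ⟩
              0# - 0#                      ≡⟨ -‿inverseʳ 0# ⟩
              0#                           ∎)
          , x+x≡0⇒x≡0 (begin
              (a + c) + (a + c)            ≡⟨ solve 3 (λ a b c → (a :+ c) :+ (a :+ c) := (a :+ b :+ c) :+ (a :- b :+ c)) ≡.refl a b c ⟩
              (a + b + c) + (a - b + c)    ≡⟨ ≡.cong₂ _+_ (≡.trans (≡.sym quadratic-e₊) Q₊) (≡.trans (≡.sym quadratic-e₋) Q₋) ⟩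
              0# + 0#                      ≡⟨ +-identityʳ 0# ⟩
              0#                           ∎)

        zero-at-e₂e₊e₋ : quadratic e₂ ≡ 0# → quadratic e₊ ≡ 0# → quadratic e₋ ≡ 0# → Zero
        zero-at-e₂e₊e₋ Q₂ Q₊ Q₋ = x+y≡0⇒x≡0⇒y≡0 (≡.trans (+-comm c a) a+c≡0) c≡0 , b≡0 , c≡0
          where
          c≡0 = ≡.trans (≡.sym quadratic-e₂) Q₂
          b≡0 = proj₁ (zero-at-e₊e₋ Q₊ Q₋)
          a+c≡0 = proj₂ (zero-at-e₊e₋ Q₊ Q₋)

        zero-at-e₁e₊e₋ : quadratic e₁ ≡ 0# → quadratic e₊ ≡ 0# → quadratic e₋ ≡ 0# → Zero
        zero-at-e₁e₊e₋ Q₁ Q₊ Q₋ = a≡0 , proj₁ (zero-at-e₊e₋ Q₊ Q₋) , x+y≡0⇒x≡0⇒y≡0 (proj₂ (zero-at-e₊e₋ Q₊ Q₋)) a≡0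
          where a≡0 = ≡.trans (≡.sym quadratic-e₁) Q₁

        zero-at-e₁e₂ : ∀ {s} → quadratic e₁ ≡ 0# → quadratic e₂ ≡ 0# → (b ≡ s - a - c ⊎ - b ≡ s - a - c) → s ≡ 0# → Zero
        zero-at-e₁e₂ {s} Q₁ Q₂ ±b≡s-a-c s≡0 = a≡0 , [ (λ b≡ → ≡.trans b≡ rest≡0) , (λ -b≡ → -x≡0⇒x≡0 (≡.trans -b≡ rest≡0)) ]′ ±b≡s-a-c , c≡0
          where
          a≡0 = ≡.trans (≡.sym quadratic-e₁) Q₁
          c≡0 = ≡.trans (≡.sym quadratic-e₂) Q₂
          rest≡0 : s - a - c ≡ 0#
          rest≡0 = ≡.trans (≡.cong₂ (λ u v → u - v - c) s≡0 a≡0) (≡.trans (≡.cong (λ t → 0# - 0# - t) c≡0) (solve 0 (:0 :- :0 :- :0 := :0) ≡.refl))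

        zero-at-e₁e₂e₊ : quadratic e₁ ≡ 0# → quadratic e₂ ≡ 0# → quadratic e₊ ≡ 0# → Zero
        zero-at-e₁e₂e₊ Q₁ Q₂ Q₊ = zero-at-e₁e₂ Q₁ Q₂ (inj₁ (solve 3 (λ a b c → b := (a :+ b :+ c) :- a :- c) ≡.refl a b c)) (≡.trans (≡.sym quadratic-e₊) Q₊)

        zero-at-e₁e₂e₋ : quadratic e₁ ≡ 0# → quadratic e₂ ≡ 0# → quadratic e₋ ≡ 0# → Zero
        zero-at-e₁e₂e₋ Q₁ Q₂ Q₋ = zero-at-e₁e₂ Q₁ Q₂ (inj₂ (solve 3 (λ a b c → :- b := (a :- b :+ c) :- a :- c) ≡.refl a b c)) (≡.trans (≡.sym quadratic-e₋) Q₋)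

        nonzero-at : ∀ {d x} → linear d ≡ x → x ≢ 0# → linear d ≢ 0#
        nonzero-at Ld≡x x≢0 Ld≡0 = x≢0 (≡.trans (≡.sym Ld≡x) Ld≡0)

        one-of-three : ∀ d e f → linear d ≢ 0# → linear e ≢ 0# → linear f ≢ 0# →
          (quadratic d ≡ 0# → quadratic e ≡ 0# → quadratic f ≡ 0# → Zero) → ¬ Zero → Σ (A × A) BothNonZeroAt
        one-of-three d e f Ld≢0 Le≢0 Lf≢0 zero-at-def q≢0 with quadratic d ≟ 0# | quadratic e ≟ 0# | quadratic f ≟ 0#
        ... | no Qd≢0 | _ | _ = d , Ld≢0 , Qd≢0
        ... | yes _ | no Qe≢0 | _ = e , Le≢0 , Qe≢0
        ... | yes _ | yes _ | no Qf≢0 = f , Lf≢0 , Qf≢0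
        ... | yes Qd≡0 | yes Qe≡0 | yes Qf≡0 = ⊥-elim (q≢0 (zero-at-def Qd≡0 Qe≡0 Qf≡0))

      -- L vanishes at no more than one of the directions (1,0), (0,1), (1,1), (1,−1), and Q at no more than two.
      common-non-zero : ¬ (l₁ ≡ 0# × l₂ ≡ 0#) → ¬ (a ≡ 0# × b ≡ 0# × c ≡ 0#) → Σ (A × A) BothNonZeroAt
      common-non-zero l≢0 with l₁ ≟ 0# | l₂ ≟ 0# | (l₁ + l₂) ≟ 0#
      ... | yes l₁≡0 | _ | _ =
        one-of-three e₂ e₊ e₋ (nonzero-at linear-e₂ l₂≢0) (nonzero-at (≡.trans linear-e₊ l₁+l₂≡l₂) l₂≢0)
          (nonzero-at (≡.trans linear-e₋ l₁-l₂≡-l₂) (λ -l₂≡0 → l₂≢0 (-x≡0⇒x≡0 -l₂≡0))) zero-at-e₂e₊e₋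
        where
        l₂≢0 : l₂ ≢ 0#
        l₂≢0 l₂≡0 = l≢0 (l₁≡0 , l₂≡0)
        l₁+l₂≡l₂ : l₁ + l₂ ≡ l₂
        l₁+l₂≡l₂ = ≡.trans (≡.cong (_+ l₂) l₁≡0) (+-identityˡ l₂)
        l₁-l₂≡-l₂ : l₁ - l₂ ≡ - l₂
        l₁-l₂≡-l₂ = ≡.trans (≡.cong (_- l₂) l₁≡0) (+-identityˡ (- l₂))
      ... | no l₁≢0 | yes l₂≡0 | _ =
        one-of-three e₁ e₊ e₋ (nonzero-at linear-e₁ l₁≢0) (nonzero-at (≡.trans linear-e₊ l₁+l₂≡l₁) l₁≢0)
          (nonzero-at (≡.trans linear-e₋ l₁-l₂≡l₁) l₁≢0) zero-at-e₁e₊e₋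
        where
        l₁+l₂≡l₁ : l₁ + l₂ ≡ l₁
        l₁+l₂≡l₁ = ≡.trans (≡.cong (l₁ +_) l₂≡0) (+-identityʳ l₁)
        l₁-l₂≡l₁ : l₁ - l₂ ≡ l₁
        l₁-l₂≡l₁ = ≡.trans (≡.cong (λ t → l₁ - t) l₂≡0) (solve 1 (λ x → x :- :0 := x) ≡.refl l₁)
      ... | no l₁≢0 | no l₂≢0 | yes l₁+l₂≡0 =
        one-of-three e₁ e₂ e₋ (nonzero-at linear-e₁ l₁≢0) (nonzero-at linear-e₂ l₂≢0) (nonzero-at linear-e₋ l₁-l₂≢0) zero-at-e₁e₂e₋
        where
        l₁-l₂≢0 : l₁ - l₂ ≢ 0#
        l₁-l₂≢0 l₁-l₂≡0 = l₁≢0 (x+x≡0⇒x≡0 (begin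
          l₁ + l₁                  ≡⟨ solve 2 (λ l₁ l₂ → l₁ :+ l₁ := (l₁ :+ l₂) :+ (l₁ :- l₂)) ≡.refl l₁ l₂ ⟩
          (l₁ + l₂) + (l₁ - l₂)    ≡⟨ ≡.cong₂ _+_ l₁+l₂≡0 l₁-l₂≡0 ⟩
          0# + 0#                  ≡⟨ +-identityʳ 0# ⟩
          0#                       ∎))
      ... | no l₁≢0 | no l₂≢0 | no l₁+l₂≢0 =
        one-of-three e₁ e₂ e₊ (nonzero-at linear-e₁ l₁≢0) (nonzero-at linear-e₂ l₂≢0) (nonzero-at linear-e₊ l₁+l₂≢0) zero-at-e₁e₂e₊

module FiniteFieldProperties (F : FiniteField) where
  open import Data.Nat using (ℕ; zero; suc)
  open import Data.Nat.DivMod using (_%_; _/_; m≡m%n+[m/n]*n; m%n<n)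
  open import Data.Nat.Divisibility using (divides)
  open import Data.Nat.Primality using (Prime; prime⇒irreducible)
  open import Data.Fin as Fin using (Fin; zero; suc; punchIn)
  import Data.Fin.Properties as Finₚ
  open import Data.Fin.Permutation using (Permutation; permutation)
  open import Data.Product as Σ using (Σ; _,_)
  open import Data.Sum using ([_,_]′)
  open import Data.Empty using (⊥-elim)
  open import Function.Bundles using (Inverse)

  open import Relation.Nullary using (Dec; yes; no)
  import Algebra.Properties.CommutativeMonoid.Sum as MonoidSum
  import Algebra.Properties.Semiring.Mult as SemiringMult
  import Algebra.Properties.Semiring.Exp as SemiringExp
  open ≡.≡-Reasoning

  open FiniteField F

  enum : Fin size → Carrier
  enum = Inverse.to enumeration

  index : Carrier → Fin size
  index = Inverse.from enumeration

  enum-index : ∀ x → enum (index x) ≡ x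
  enum-index = Inverse.strictlyInverseˡ enumeration

  index-enum : ∀ i → index (enum i) ≡ i
  index-enum = Inverse.strictlyInverseʳ enumeration

  infix 4 _≟_
  _≟_ : (x y : Carrier) → Dec (x ≡ y)
  x ≟ y with index x Fin.≟ index y
  ... | yes same = yes (≡.trans (≡.sym (enum-index x)) (≡.trans (≡.cong enum same) (enum-index y)))
  ... | no different = no (λ x≡y → different (≡.cong index x≡y))

  1≢0 : 1# ≢ 0#
  1≢0 1≡0 = 0≢1 (≡.sym 1≡0)

  open FieldProperties isCommutativeRing _≟_ inverse 1≢0 public
  open CommutativeRing commutativeRing using (+-commutativeMonoid; *-commutativeMonoid; semiring; -‿inverseʳ; +-identityˡ; +-identityʳ; *-identityˡ; *-identityʳ; zeroˡ; zeroʳ; *-comm; _-_)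
  open IntegerRingSolver commutativeRing using (solve; _:+_; _:*_; _:-_; :-_; :0; :1; _:=_)
  open SemiringMult semiring using (_×_) public
  open SemiringMult semiring using (×-assocˡ; ×1-homo-*)
  open SemiringExp semiring using (_^_) public
  private
    module ∑ = MonoidSum +-commutativeMonoid
    module ∏ = MonoidSum *-commutativeMonoid

  permutationOf : (f g : Carrier → Carrier) → (∀ x → f (g x) ≡ x) → (∀ x → g (f x) ≡ x) → Permutation size size
  permutationOf f g fg gf = permutation (λ i → index (f (enum i))) (λ i → index (g (enum i)))
    (λ i → ≡.trans (≡.cong (λ t → index (f t)) (enum-index _)) (≡.trans (≡.cong index (fg (enum i))) (index-enum i)))
    (λ i → ≡.trans (≡.cong (λ t → index (g t)) (enum-index _)) (≡.trans (≡.cong index (gf (enum i))) (index-enum i)))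

  -- Translating every element by 1 permutes the field, so the sum of all elements is unchanged.
  size×1≡0 : size × 1# ≡ 0#
  size×1≡0 = begin
    size × 1#                         ≡⟨ solve 2 (λ s t → (s :+ t) :- s := t) ≡.refl total (size × 1#) ⟨
    (total + size × 1#) - total       ≡⟨ ≡.cong (_- total) translated-total ⟨
    total - total                     ≡⟨ -‿inverseʳ total ⟩
    0#                                ∎
    where
    total = ∑.sum enum
    translation = permutationOf (_+ 1#) (_- 1#) (solve 1 (λ x → x :- :1 :+ :1 := x) ≡.refl) (solve 1 (λ x → x :+ :1 :- :1 := x) ≡.refl)
    translated-total : total ≡ total + size × 1#
    translated-total = begin
      total                         ≡⟨ ∑.∑-permute enum translation ⟩
      _                             ≡⟨ ∑.sum-cong-≗ (λ i → enum-index (enum i + 1#)) ⟩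
      ∑.sum (λ i → enum i + 1#)     ≡⟨ ∑.∑-distrib-+ enum (λ _ → 1#) ⟩
      total + ∑.sum {size} (λ _ → 1#) ≡⟨ ≡.cong (total +_) (∑.sum-replicate size) ⟩
      total + size × 1#             ∎

  private
    nonZeroPart : Carrier → Carrier
    nonZeroPart y with y ≟ 0#
    ... | yes _ = 1#
    ... | no _ = y

    nonZeroPart-0 : ∀ {y} → y ≡ 0# → nonZeroPart y ≡ 1#
    nonZeroPart-0 {y} y≡0 with y ≟ 0#
    ... | yes _ = ≡.refl
    ... | no y≢0 = ⊥-elim (y≢0 y≡0)

    nonZeroPart-≢0 : ∀ {y} → y ≢ 0# → nonZeroPart y ≡ y
    nonZeroPart-≢0 {y} y≢0 with y ≟ 0#
    ... | yes y≡0 = ⊥-elim (y≢0 y≡0)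
    ... | no _ = ≡.refl

    nonZeroPart≢0 : ∀ y → nonZeroPart y ≢ 0#
    nonZeroPart≢0 y with y ≟ 0#
    ... | yes _ = 1≢0
    ... | no y≢0 = y≢0

    product≢0 : ∀ {n} (f : Fin n → Carrier) → (∀ j → f j ≢ 0#) → ∏.sum f ≢ 0#
    product≢0 {zero} f _ = 1≢0
    product≢0 {suc n} f f≢0 = *-≢0 (f≢0 zero) (product≢0 (λ j → f (suc j)) (λ j → f≢0 (suc j)))

    product-of-ones : ∀ {n} (f : Fin n → Carrier) → (∀ j → f j ≡ 1#) → ∏.sum f ≡ 1#
    product-of-ones {zero} f _ = ≡.refl
    product-of-ones {suc n} f f≡1 = ≡.trans (≡.cong₂ _*_ (f≡1 zero) (product-of-ones (λ j → f (suc j)) (λ j → f≡1 (suc j)))) (*-identityˡ 1#)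

    product-supported-at : ∀ {n} (f : Fin n → Carrier) i → (∀ j → j ≢ i → f j ≡ 1#) → ∏.sum f ≡ f i
    product-supported-at {suc n} f i f≡1 = begin
      ∏.sum f                             ≡⟨ ∏.sum-remove {i = i} f ⟩
      f i * ∏.sum (λ j → f (punchIn i j)) ≡⟨ ≡.cong (f i *_) (product-of-ones _ (λ j → f≡1 (punchIn i j) (Finₚ.punchInᵢ≢i i j))) ⟩
      f i * 1#                            ≡⟨ *-identityʳ (f i) ⟩
      f i                                 ∎

    0^n≡0 : ∀ {n} → Fin n → 0# ^ n ≡ 0#
    0^n≡0 {suc n} _ = zeroˡ _

    module Scaling {a : Carrier} (a≢0 : a ≢ 0#) where

      correction : Carrier → Carrier
      correction y with y ≟ 0#
      ... | yes _ = a
      ... | no _ = 1#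

      scaled-nonZeroPart : ∀ y → a * nonZeroPart y ≡ nonZeroPart (a * y) * correction y
      scaled-nonZeroPart y with y ≟ 0#
      ... | yes y≡0 = begin
        a * 1#                      ≡⟨ *-identityʳ a ⟩
        a                           ≡⟨ *-identityˡ a ⟨
        1# * a                      ≡⟨ ≡.cong (_* a) (nonZeroPart-0 (≡.trans (≡.cong (a *_) y≡0) (zeroʳ a))) ⟨
        nonZeroPart (a * y) * a     ∎
      ... | no y≢0 = begin
        a * y                       ≡⟨ *-identityʳ _ ⟨
        (a * y) * 1#                ≡⟨ ≡.cong (_* 1#) (nonZeroPart-≢0 (*-≢0 a≢0 y≢0)) ⟨
        nonZeroPart (a * y) * 1#    ∎

      product-of-correction : ∏.sum (λ i → correction (enum i)) ≡ a
      product-of-correction = ≡.trans (product-supported-at (λ i → correction (enum i)) (index 0#) elsewhere) at-0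
        where
        at-0 : correction (enum (index 0#)) ≡ a
        at-0 with enum (index 0#) ≟ 0#
        ... | yes _ = ≡.refl
        ... | no e≢0 = ⊥-elim (e≢0 (enum-index 0#))
        elsewhere : ∀ j → j ≢ index 0# → correction (enum j) ≡ 1#
        elsewhere j j≢i₀ with enum j ≟ 0#
        ... | yes e≡0 = ⊥-elim (j≢i₀ (≡.trans (≡.sym (index-enum j)) (≡.cong index e≡0)))
        ... | no _ = ≡.refl

      scaling-permutes : ∏.sum (λ i → nonZeroPart (a * enum i)) ≡ ∏.sum (λ i → nonZeroPart (enum i))
      scaling-permutes = ≡.sym (≡.trans (∏.∑-permute (λ i → nonZeroPart (enum i)) scaling) (∏.sum-cong-≗ (λ i → ≡.cong nonZeroPart (enum-index (a * enum i)))))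
        where
        a⁻¹ = Σ.proj₁ (inverse a a≢0)
        cancel : ∀ x → (a * a⁻¹) * x ≡ x
        cancel x = ≡.trans (≡.cong (_* x) (Σ.proj₂ (inverse a a≢0))) (*-identityˡ x)
        scaling = permutationOf (a *_) (a⁻¹ *_)
          (λ x → ≡.trans (solve 3 (λ a b x → a :* (b :* x) := (a :* b) :* x) ≡.refl a a⁻¹ x) (cancel x))
          (λ x → ≡.trans (solve 3 (λ a b x → b :* (a :* x) := (a :* b) :* x) ≡.refl a a⁻¹ x) (cancel x))

  -- With y′ the element y with 0 replaced by 1, multiply a y′ = (a y)′ · (a if y = 0 else 1) over all y;
  -- as y ↦ a y permutes the field, this reads a^q ∏ y′ = a ∏ y′.
  fermat : ∀ a → a ^ size ≡ a
  fermat a with a ≟ 0#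
  ... | yes ≡.refl = 0^n≡0 (index 0#)
  ... | no a≢0 = *-cancelˡ (product≢0 (λ i → nonZeroPart (enum i)) (λ i → nonZeroPart≢0 (enum i))) (begin
    P * a ^ size                                                ≡⟨ *-comm P _ ⟩
    a ^ size * P                                                ≡⟨ ≡.cong (_* P) (∏.sum-replicate size) ⟨
    ∏.sum {size} (λ _ → a) * P                                  ≡⟨ ∏.∑-distrib-+ (λ _ → a) (λ i → nonZeroPart (enum i)) ⟨
    ∏.sum (λ i → a * nonZeroPart (enum i))                      ≡⟨ ∏.sum-cong-≗ (λ i → scaled-nonZeroPart (enum i)) ⟩
    ∏.sum (λ i → nonZeroPart (a * enum i) * correction (enum i)) ≡⟨ ∏.∑-distrib-+ (λ i → nonZeroPart (a * enum i)) (λ i → correction (enum i)) ⟩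
    ∏.sum (λ i → nonZeroPart (a * enum i)) * ∏.sum (λ i → correction (enum i)) ≡⟨ ≡.cong₂ _*_ scaling-permutes product-of-correction ⟩
    P * a                                                       ∎)
    where
    P = ∏.sum (λ i → nonZeroPart (enum i))
    open Scaling a≢0

  module OddCharacteristic {p n : ℕ} (p-prime : Prime p) (p≢2 : p ≢ 2) (size≡p^n : size ≡ p ℕ.^ n) where

    private
      [p^k]×1≡[p×1]^k : ∀ k → (p ℕ.^ k) × 1# ≡ (p × 1#) ^ k
      [p^k]×1≡[p×1]^k zero = +-identityʳ 1#
      [p^k]×1≡[p×1]^k (suc k) = ≡.trans (×1-homo-* p (p ℕ.^ k)) (≡.cong ((p × 1#) *_) ([p^k]×1≡[p×1]^k k))

      x^k≡0⇒x≡0 : ∀ {x} k → x ^ k ≡ 0# → x ≡ 0#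
      x^k≡0⇒x≡0 zero 1≡0 = ⊥-elim (1≢0 1≡0)
      x^k≡0⇒x≡0 {x} (suc k) xx^k≡0 = [ (λ x≡0 → x≡0) , x^k≡0⇒x≡0 k ]′ (x*y≡0⇒x≡0∨y≡0 x (x ^ k) xx^k≡0)

      m×0≡0 : ∀ m → m × 0# ≡ 0#
      m×0≡0 zero = ≡.refl
      m×0≡0 (suc m) = ≡.trans (+-identityˡ (m × 0#)) (m×0≡0 m)

      p≡1+[p/2]*2 : p ≡ suc (p / 2 ℕ.* 2)
      p≡1+[p/2]*2 with p % 2 | m≡m%n+[m/n]*n p 2 | m%n<n p 2
      ... | 0 | p≡[p/2]*2 | _ = ⊥-elim ([ (λ ()) , (λ 2≡p → p≢2 (≡.sym 2≡p)) ]′ (prime⇒irreducible p-prime (divides (p / 2) p≡[p/2]*2)))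
      ... | 1 | p≡1+[p/2]*2 | _ = p≡1+[p/2]*2
      ... | suc (suc _) | _ | ℕ.s≤s (ℕ.s≤s ())

    p×1≡0 : p × 1# ≡ 0#
    p×1≡0 = x^k≡0⇒x≡0 n (≡.trans (≡.sym ([p^k]×1≡[p×1]^k n)) (≡.trans (≡.cong (_× 1#) (≡.sym size≡p^n)) size×1≡0))

    1+1≢0 : 1# + 1# ≢ 0#
    1+1≢0 1+1≡0 = 0≢1 (begin
      0#                              ≡⟨ p×1≡0 ⟨
      p × 1#                          ≡⟨ ≡.cong (_× 1#) p≡1+[p/2]*2 ⟩
      1# + (p / 2 ℕ.* 2) × 1#         ≡⟨ ≡.cong (1# +_) (×-assocˡ 1# (p / 2) 2) ⟨
      1# + (p / 2) × (1# + (1# + 0#)) ≡⟨ ≡.cong (λ t → 1# + (p / 2) × (1# + t)) (+-identityʳ 1#) ⟩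
      1# + (p / 2) × (1# + 1#)        ≡⟨ ≡.cong (λ t → 1# + (p / 2) × t) 1+1≡0 ⟩
      1# + (p / 2) × 0#               ≡⟨ ≡.cong (1# +_) (m×0≡0 (p / 2)) ⟩
      1# + 0#                         ≡⟨ +-identityʳ 1# ⟩
      1#                              ∎)

module QuadraticExtension (F : FiniteField) (w : FiniteField.Carrier F)
  (w-nonsquare : ∀ s → FiniteField._*_ F s s ≢ w) where
  open import Data.Nat using (ℕ; zero; suc)
  open import Data.Product as Σ using (Σ; _×_; _,_; proj₁; proj₂)
  open import Data.Sum using (inj₁; inj₂)
  open import Relation.Nullary using (Dec; yes; no)
  open ≡.≡-Reasoning

  open FiniteField F
  open FiniteFieldProperties F hiding (_×_) renaming (_^_ to _^ᶠ_)
  open CommutativeRing commutativeRing using (_-_; zeroˡ; +-assoc; +-comm; +-identityˡ; +-identityʳ; -‿inverseˡ; -‿inverseʳ)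
  open IntegerRingSolver commutativeRing using (solve; Polynomial; _:+_; _:*_; _:-_; :-_; :0; :1; _:=_)
  open GF2 F w public

  -- GF(q²)-arithmetic on pairs of polynomials, W standing for w: an identity between GF(q²)-expressions
  -- is proved by solving each of its two components over GF(q).
  module Componentwise {m : ℕ} (W : Polynomial m) where

    Pair : Set
    Pair = Polynomial m × Polynomial m

    infixl 6 _⊕ₚ_ _⊝ₚ_
    infixl 7 _⊗ₚ_

    _⊕ₚ_ _⊗ₚ_ _⊝ₚ_ : Pair → Pair → Pair
    (a₁ , a₂) ⊕ₚ (b₁ , b₂) = (a₁ :+ b₁ , a₂ :+ b₂)
    (a₁ , a₂) ⊗ₚ (b₁ , b₂) = (a₁ :* b₁ :+ W :* (a₂ :* b₂) , a₁ :* b₂ :+ a₂ :* b₁)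
    (a₁ , a₂) ⊝ₚ (b₁ , b₂) = (a₁ :+ :- b₁ , a₂ :+ :- b₂)

    embₚ : Polynomial m → Pair
    embₚ a = (a , :0)

    NormP : Pair → Polynomial m
    NormP (a₁ , a₂) = a₁ :* a₁ :- W :* (a₂ :* a₂)

    𝟙ₚ εₚ : Pair
    𝟙ₚ = embₚ :1
    εₚ = (:0 , :1)

  ⊕-assoc : ∀ x y z → (x ⊕ y) ⊕ z ≡ x ⊕ (y ⊕ z)
  ⊕-assoc (x₁ , x₂) (y₁ , y₂) (z₁ , z₂) = ≡.cong₂ _,_ (+-assoc x₁ y₁ z₁) (+-assoc x₂ y₂ z₂)

  ⊗-assoc : ∀ x y z → (x ⊗ y) ⊗ z ≡ x ⊗ (y ⊗ z)
  ⊗-assoc (x₁ , x₂) (y₁ , y₂) (z₁ , z₂) = ≡.cong₂ _,_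
    (solve 7 (λ W a₁ a₂ b₁ b₂ c₁ c₂ → let open Componentwise W in
       proj₁ (((a₁ , a₂) ⊗ₚ (b₁ , b₂)) ⊗ₚ (c₁ , c₂)) := proj₁ ((a₁ , a₂) ⊗ₚ ((b₁ , b₂) ⊗ₚ (c₁ , c₂)))) ≡.refl w x₁ x₂ y₁ y₂ z₁ z₂)
    (solve 7 (λ W a₁ a₂ b₁ b₂ c₁ c₂ → let open Componentwise W in
       proj₂ (((a₁ , a₂) ⊗ₚ (b₁ , b₂)) ⊗ₚ (c₁ , c₂)) := proj₂ ((a₁ , a₂) ⊗ₚ ((b₁ , b₂) ⊗ₚ (c₁ , c₂)))) ≡.refl w x₁ x₂ y₁ y₂ z₁ z₂)

  ⊗-comm : ∀ x y → x ⊗ y ≡ y ⊗ x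
  ⊗-comm (x₁ , x₂) (y₁ , y₂) = ≡.cong₂ _,_
    (solve 5 (λ W a₁ a₂ b₁ b₂ → a₁ :* b₁ :+ W :* (a₂ :* b₂) := b₁ :* a₁ :+ W :* (b₂ :* a₂)) ≡.refl w x₁ x₂ y₁ y₂)
    (solve 4 (λ a₁ a₂ b₁ b₂ → a₁ :* b₂ :+ a₂ :* b₁ := b₁ :* a₂ :+ b₂ :* a₁) ≡.refl x₁ x₂ y₁ y₂)

  ⊗-identityˡ : ∀ x → 𝟙 ⊗ x ≡ x
  ⊗-identityˡ (x₁ , x₂) = ≡.cong₂ _,_
    (solve 3 (λ W a b → :1 :* a :+ W :* (:0 :* b) := a) ≡.refl w x₁ x₂)
    (solve 2 (λ a b → :1 :* b :+ :0 :* a := b) ≡.refl x₁ x₂)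

  ⊗-distribˡ : ∀ x y z → x ⊗ (y ⊕ z) ≡ x ⊗ y ⊕ x ⊗ z
  ⊗-distribˡ (x₁ , x₂) (y₁ , y₂) (z₁ , z₂) = ≡.cong₂ _,_
    (solve 7 (λ W a₁ a₂ b₁ b₂ c₁ c₂ → let open Componentwise W in
       proj₁ ((a₁ , a₂) ⊗ₚ ((b₁ , b₂) ⊕ₚ (c₁ , c₂))) := proj₁ ((a₁ , a₂) ⊗ₚ (b₁ , b₂) ⊕ₚ (a₁ , a₂) ⊗ₚ (c₁ , c₂))) ≡.refl w x₁ x₂ y₁ y₂ z₁ z₂)
    (solve 6 (λ a₁ a₂ b₁ b₂ c₁ c₂ → a₁ :* (b₂ :+ c₂) :+ a₂ :* (b₁ :+ c₁) := (a₁ :* b₂ :+ a₂ :* b₁) :+ (a₁ :* c₂ :+ a₂ :* c₁)) ≡.refl x₁ x₂ y₁ y₂ z₁ z₂)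

  isCommutativeRing-GF : IsCommutativeRing _≡_ _⊕_ _⊗_ ⊖_ 𝟘 𝟙
  isCommutativeRing-GF = record
    { isRing = record
      { +-isAbelianGroup = record
        { isGroup = record
          { isMonoid = record
            { isSemigroup = record { isMagma = record { isEquivalence = ≡.isEquivalence ; ∙-cong = ≡.cong₂ _⊕_ } ; assoc = ⊕-assoc }
            ; identity = (λ (x₁ , x₂) → ≡.cong₂ _,_ (+-identityˡ x₁) (+-identityˡ x₂))
                       , (λ (x₁ , x₂) → ≡.cong₂ _,_ (+-identityʳ x₁) (+-identityʳ x₂)) }
          ; inverse = (λ (x₁ , x₂) → ≡.cong₂ _,_ (-‿inverseˡ x₁) (-‿inverseˡ x₂))
                    , (λ (x₁ , x₂) → ≡.cong₂ _,_ (-‿inverseʳ x₁) (-‿inverseʳ x₂))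
          ; ⁻¹-cong = ≡.cong ⊖_ }
        ; comm = λ (x₁ , x₂) (y₁ , y₂) → ≡.cong₂ _,_ (+-comm x₁ y₁) (+-comm x₂ y₂) }
      ; *-cong = ≡.cong₂ _⊗_
      ; *-assoc = ⊗-assoc
      ; *-identity = ⊗-identityˡ , (λ x → ≡.trans (⊗-comm x 𝟙) (⊗-identityˡ x))
      ; distrib = ⊗-distribˡ , (λ x y z → ≡.trans (⊗-comm (y ⊕ z) x) (≡.trans (⊗-distribˡ x y z) (≡.cong₂ _⊕_ (⊗-comm x y) (⊗-comm x z))))
      }
    ; *-comm = ⊗-comm
    }

  norm : GF → Carrier
  norm (a , b) = a * a - w * (b * b)

  w≢0 : w ≢ 0#
  w≢0 w≡0 = w-nonsquare 0# (≡.trans (zeroˡ 0#) (≡.sym w≡0))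

  norm≢0 : ∀ x → x ≢ 𝟘 → norm x ≢ 0#
  norm≢0 (a , b) x≢0 norm≡0 with b ≟ 0#
  ... | yes b≡0 = x≢0 (≡.cong₂ _,_ a≡0 b≡0)
    where
    a*a≡0 : a * a ≡ 0#
    a*a≡0 = ≡.trans (x-y≡0⇒x≡y norm≡0) (≡.trans (≡.cong (λ t → w * (t * t)) b≡0) (solve 1 (λ w → w :* (:0 :* :0) := :0) ≡.refl w))
    a≡0 : a ≡ 0#
    a≡0 with x*y≡0⇒x≡0∨y≡0 a a a*a≡0
    ... | inj₁ a≡0 = a≡0
    ... | inj₂ a≡0 = a≡0
  ... | no b≢0 with inverse b b≢0
  ... | b⁻¹ , bb⁻¹≡1 = w-nonsquare (a * b⁻¹) (begin
    (a * b⁻¹) * (a * b⁻¹)       ≡⟨ solve 2 (λ a c → (a :* c) :* (a :* c) := (a :* a) :* (c :* c)) ≡.refl a b⁻¹ ⟩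
    (a * a) * (b⁻¹ * b⁻¹)       ≡⟨ ≡.cong (_* (b⁻¹ * b⁻¹)) (x-y≡0⇒x≡y norm≡0) ⟩
    (w * (b * b)) * (b⁻¹ * b⁻¹) ≡⟨ solve 3 (λ w b c → (w :* (b :* b)) :* (c :* c) := w :* ((b :* c) :* (b :* c))) ≡.refl w b b⁻¹ ⟩
    w * ((b * b⁻¹) * (b * b⁻¹)) ≡⟨ ≡.cong (λ t → w * (t * t)) bb⁻¹≡1 ⟩
    w * (1# * 1#)               ≡⟨ solve 1 (λ w → w :* (:1 :* :1) := w) ≡.refl w ⟩
    w                           ∎)

  inverse-GF : ∀ x → x ≢ 𝟘 → Σ GF λ y → x ⊗ y ≡ 𝟙
  inverse-GF (a , b) x≢0 with inverse (norm (a , b)) (norm≢0 (a , b) x≢0)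
  ... | t , norm·t≡1 = (a * t , - (b * t)) , ≡.cong₂ _,_
    (≡.trans (solve 4 (λ w a b t → a :* (a :* t) :+ w :* (b :* (:- (b :* t))) := (a :* a :- w :* (b :* b)) :* t) ≡.refl w a b t) norm·t≡1)
    (solve 3 (λ a b t → a :* (:- (b :* t)) :+ b :* (a :* t) := :0) ≡.refl a b t)

  infix 4 _≟ᴳ_
  _≟ᴳ_ : (x y : GF) → Dec (x ≡ y)
  (a , b) ≟ᴳ (c , d) with a ≟ c | b ≟ d
  ... | yes a≡c | yes b≡d = yes (≡.cong₂ _,_ a≡c b≡d)
  ... | no a≢c | _ = no (λ x≡y → a≢c (≡.cong proj₁ x≡y))
  ... | _ | no b≢d = no (λ x≡y → b≢d (≡.cong proj₂ x≡y))

  𝟙≢𝟘 : 𝟙 ≢ 𝟘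
  𝟙≢𝟘 𝟙≡𝟘 = 0≢1 (≡.sym (≡.cong proj₁ 𝟙≡𝟘))

  module ᴳ = FieldProperties isCommutativeRing-GF _≟ᴳ_ inverse-GF 𝟙≢𝟘

  emb-⊗ : ∀ a b → emb a ⊗ emb b ≡ emb (a * b)
  emb-⊗ a b = ≡.cong₂ _,_ (solve 3 (λ w a b → a :* b :+ w :* (:0 :* :0) := a :* b) ≡.refl w a b) (solve 2 (λ a b → a :* :0 :+ :0 :* b := :0) ≡.refl a b)

  emb-^ : ∀ a n → emb a ^ n ≡ emb (a ^ᶠ n)
  emb-^ a zero = ≡.refl
  emb-^ a (suc n) = ≡.trans (≡.cong (emb a ⊗_) (emb-^ a n)) (emb-⊗ a (a ^ᶠ n))

  ε⊗ε≡w : ε ⊗ ε ≡ emb w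
  ε⊗ε≡w = ≡.cong₂ _,_ (solve 1 (λ w → :0 :* :0 :+ w :* (:1 :* :1) := w) ≡.refl w) (solve 0 (:0 :* :1 :+ :1 :* :0 := :0) ≡.refl)

  norm-⊗ : ∀ x y → norm (x ⊗ y) ≡ norm x * norm y
  norm-⊗ (x₁ , x₂) (y₁ , y₂) = solve 5 (λ W x₁ x₂ y₁ y₂ → let open Componentwise W in
    NormP ((x₁ , x₂) ⊗ₚ (y₁ , y₂)) := NormP (x₁ , x₂) :* NormP (y₁ , y₂)) ≡.refl w x₁ x₂ y₁ y₂

module Conjugation (F : FiniteField) (w : FiniteField.Carrier F)
  (w-nonsquare : ∀ s → FiniteField._*_ F s s ≢ w)
  {p n : ℕ} (p-prime : Prime p) (p≢2 : p ≢ 2) (size≡p^n : FiniteField.size F ≡ p ℕ.^ n) where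
  open import Data.Nat using (zero; suc)
  open import Data.Product as Σ using (Σ; _,_; proj₁; proj₂)
  open import Data.Sum using (_⊎_; [_,_]′)
  open import Data.Empty using (⊥-elim)
  open import Data.Fin as Fin using (Fin; zero; suc; cast)
  import Data.Fin.Properties as Finₚ
  open import Data.Vec using (Vec; _∷_; replicate)
  open import Function.Definitions using (Injective)
  open import Function.Base using (_∘_)
  import Algebra.Properties.Semiring.Exp as SemiringExp
  import Algebra.Properties.CommutativeSemiring.Exp as CommutativeSemiringExp
  import Algebra.Properties.Semiring.Mult as SemiringMult
  open ≡.≡-Reasoning

  open FiniteField F
  open FiniteFieldProperties F using (enum; index; index-enum; fermat; module OddCharacteristic; commutativeRing)
  open OddCharacteristic {n = n} p-prime p≢2 size≡p^n using (p×1≡0)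
  open QuadraticExtension F w w-nonsquare
  open IntegerRingSolver commutativeRing using (solve; _:+_; _:*_; _:-_; :-_; :0; :1; _:=_)
  open CommutativeRing commutativeRing using (+-identityˡ)

  private
    module ᴳRing = CommutativeRing ᴳ.commutativeRing
    module ᴳSolver = IntegerRingSolver ᴳ.commutativeRing
    open SemiringExp ᴳRing.semiring using () renaming (_^_ to _^ˢ_)
    open SemiringMult ᴳRing.semiring using () renaming (_×_ to _×ᴳ_)
    open SemiringMult (CommutativeRing.semiring commutativeRing) using (_×_)

    ^ˢ≡^ : ∀ x k → x ^ˢ k ≡ x ^ k
    ^ˢ≡^ x zero = ≡.refl
    ^ˢ≡^ x (suc k) = ≡.cong (x ⊗_) (^ˢ≡^ x k)

    k×𝟙≡emb[k×1] : ∀ k → k ×ᴳ 𝟙 ≡ emb (k × 1#)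
    k×𝟙≡emb[k×1] zero = ≡.refl
    k×𝟙≡emb[k×1] (suc k) = ≡.trans (≡.cong (𝟙 ⊕_) (k×𝟙≡emb[k×1] k)) (≡.cong (1# + k × 1# ,_) (+-identityˡ 0#))

    p×𝟙≡𝟘 : p ×ᴳ 𝟙 ≡ 𝟘
    p×𝟙≡𝟘 = ≡.trans (k×𝟙≡emb[k×1] p) (≡.cong emb p×1≡0)

  conj-⊕ : ∀ x y → conj (x ⊕ y) ≡ conj x ⊕ conj y
  conj-⊕ x y = begin
    (x ⊕ y) ^ size                     ≡⟨ ≡.cong ((x ⊕ y) ^_) size≡p^n ⟩
    (x ⊕ y) ^ (p ℕ.^ n)                ≡⟨ ^ˢ≡^ (x ⊕ y) (p ℕ.^ n) ⟨
    (x ⊕ y) ^ˢ (p ℕ.^ n)               ≡⟨ Frobenius.frobenius-^ ᴳRing.commutativeSemiring p-prime p×𝟙≡𝟘 n x y ⟩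
    x ^ˢ (p ℕ.^ n) ⊕ y ^ˢ (p ℕ.^ n)    ≡⟨ ≡.cong₂ _⊕_ (^ˢ≡^ x (p ℕ.^ n)) (^ˢ≡^ y (p ℕ.^ n)) ⟩
    x ^ (p ℕ.^ n) ⊕ y ^ (p ℕ.^ n)      ≡⟨ ≡.cong₂ (λ s t → x ^ s ⊕ y ^ t) size≡p^n size≡p^n ⟨
    x ^ size ⊕ y ^ size                ∎

  conj-⊗ : ∀ x y → conj (x ⊗ y) ≡ conj x ⊗ conj y
  conj-⊗ x y = begin
    (x ⊗ y) ^ size               ≡⟨ ^ˢ≡^ (x ⊗ y) size ⟨
    (x ⊗ y) ^ˢ size              ≡⟨ CommutativeSemiringExp.^-distrib-* ᴳRing.commutativeSemiring x y size ⟩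
    x ^ˢ size ⊗ y ^ˢ size        ≡⟨ ≡.cong₂ _⊗_ (^ˢ≡^ x size) (^ˢ≡^ y size) ⟩
    x ^ size ⊗ y ^ size          ∎

  conj-emb : ∀ a → conj (emb a) ≡ emb a
  conj-emb a = ≡.trans (emb-^ a size) (≡.cong emb (fermat a))

  private
    decompose : ∀ a b → (a , b) ≡ emb a ⊕ ε ⊗ emb b
    decompose a b = ≡.cong₂ _,_
      (solve 3 (λ w a b → a := a :+ (:0 :* b :+ w :* (:1 :* :0))) ≡.refl w a b)
      (solve 2 (λ a b → b := :0 :+ (:0 :* :0 :+ :1 :* b)) ≡.refl a b)

    conj-via-ε : ∀ a b → conj (a , b) ≡ emb a ⊕ conj ε ⊗ emb b
    conj-via-ε a b = begin
      conj (a , b)                            ≡⟨ ≡.cong conj (decompose a b) ⟩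
      conj (emb a ⊕ ε ⊗ emb b)                ≡⟨ conj-⊕ (emb a) (ε ⊗ emb b) ⟩
      conj (emb a) ⊕ conj (ε ⊗ emb b)         ≡⟨ ≡.cong₂ _⊕_ (conj-emb a) (≡.trans (conj-⊗ ε (emb b)) (≡.cong (conj ε ⊗_) (conj-emb b))) ⟩
      emb a ⊕ conj ε ⊗ emb b                  ∎

    conj-ε≡±ε : conj ε ≡ ε ⊎ conj ε ≡ ⊖ ε
    conj-ε≡±ε = ᴳ.x*x≡y*y⇒x≡y∨x≡-y (conj ε) ε (begin
      conj ε ⊗ conj ε    ≡⟨ conj-⊗ ε ε ⟨
      conj (ε ⊗ ε)       ≡⟨ ≡.cong conj ε⊗ε≡w ⟩
      conj (emb w)       ≡⟨ conj-emb w ⟩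
      emb w              ≡⟨ ε⊗ε≡w ⟨
      ε ⊗ ε              ∎)

    size≥2 : Σ ℕ λ k → size ≡ suc (suc k)
    size≥2 = at-least-two (index 0#) (index 1#) (λ same → 0≢1 (≡.trans (≡.sym (enum-index 0#)) (≡.trans (≡.cong enum same) (enum-index 1#))))
      where
      open FiniteFieldProperties F using (enum-index)
      at-least-two : ∀ {m} (i j : Fin m) → i ≢ j → Σ ℕ λ k → m ≡ suc (suc k)
      at-least-two {suc (suc k)} _ _ _ = k , ≡.refl
      at-least-two {suc zero} zero zero i≢j = ⊥-elim (i≢j ≡.refl)

    X^[2+k]-X : ∀ k → Vec GF (suc (suc k))
    X^[2+k]-X k = 𝟘 ∷ ⊖ 𝟙 ∷ replicate k 𝟘

    evalMonic-X^k : ∀ k x → ᴳ.evalMonic (replicate k 𝟘) x ≡ x ^ k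
    evalMonic-X^k zero x = ≡.refl
    evalMonic-X^k (suc k) x = ≡.trans (ᴳRing.+-identityˡ _) (≡.cong (x ⊗_) (evalMonic-X^k k x))

    evalMonic-X^[2+k]-X : ∀ k x → ᴳ.evalMonic (X^[2+k]-X k) x ≡ x ^ suc (suc k) ⊝ x
    evalMonic-X^[2+k]-X k x = begin
      𝟘 ⊕ x ⊗ (⊖ 𝟙 ⊕ x ⊗ ᴳ.evalMonic (replicate k 𝟘) x)   ≡⟨ ≡.cong (λ t → 𝟘 ⊕ x ⊗ (⊖ 𝟙 ⊕ x ⊗ t)) (evalMonic-X^k k x) ⟩
      𝟘 ⊕ x ⊗ (⊖ 𝟙 ⊕ x ⊗ x ^ k)                          ≡⟨ ᴳSolver.solve 2 (λ x t → ᴳSolver.:0 ᴳSolver.:+ x ᴳSolver.:* (ᴳSolver.:- ᴳSolver.:1 ᴳSolver.:+ x ᴳSolver.:* t) ᴳSolver.:= x ᴳSolver.:* (x ᴳSolver.:* t) ᴳSolver.:- x) ≡.refl x (x ^ k) ⟩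
      x ^ suc (suc k) ⊝ x                                 ∎

  -- If conjugation were the identity, X^q − X would have the q + 1 roots ε and GF(q).
  conj-ε≢ε : conj ε ≢ ε
  conj-ε≢ε conj-ε≡ε = ᴳ.monic-roots<degree (suc (suc k)) (X^[2+k]-X k) ρ ρ-injective roots
    where
    k = proj₁ size≥2
    size≡2+k = proj₂ size≥2
    ρ : Fin (suc (suc (suc k))) → GF
    ρ zero = ε
    ρ (suc i) = emb (enum (cast (≡.sym size≡2+k) i))
    ρ-injective : Injective _≡_ _≡_ ρ
    ρ-injective {zero} {zero} _ = ≡.refl
    ρ-injective {zero} {suc j} ε≡emb = ⊥-elim (0≢1 (≡.sym (≡.cong proj₂ ε≡emb)))
    ρ-injective {suc i} {zero} emb≡ε = ⊥-elim (0≢1 (≡.cong proj₂ emb≡ε))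
    ρ-injective {suc i} {suc j} emb≡emb = ≡.cong suc (Finₚ.toℕ-injective (begin
      Fin.toℕ i                                 ≡⟨ Finₚ.toℕ-cast (≡.sym size≡2+k) i ⟨
      Fin.toℕ (cast (≡.sym size≡2+k) i)         ≡⟨ ≡.cong Fin.toℕ (≡.trans (≡.sym (index-enum _)) (≡.trans (≡.cong (index ∘ proj₁) emb≡emb) (index-enum _))) ⟩
      Fin.toℕ (cast (≡.sym size≡2+k) j)         ≡⟨ Finₚ.toℕ-cast (≡.sym size≡2+k) j ⟩
      Fin.toℕ j                                 ∎))
    conj≡id : ∀ x → conj x ≡ x
    conj≡id (a , b) = ≡.trans (conj-via-ε a b) (≡.trans (≡.cong (λ t → emb a ⊕ t ⊗ emb b) conj-ε≡ε) (≡.sym (decompose a b)))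
    roots : ∀ i → ᴳ.evalMonic (X^[2+k]-X k) (ρ i) ≡ 𝟘
    roots i = begin
      ᴳ.evalMonic (X^[2+k]-X k) (ρ i)     ≡⟨ evalMonic-X^[2+k]-X k (ρ i) ⟩
      ρ i ^ suc (suc k) ⊝ ρ i             ≡⟨ ≡.cong (λ m → ρ i ^ m ⊝ ρ i) size≡2+k ⟨
      conj (ρ i) ⊝ ρ i                    ≡⟨ ≡.cong (_⊝ ρ i) (conj≡id (ρ i)) ⟩
      ρ i ⊝ ρ i                           ≡⟨ ᴳRing.-‿inverseʳ (ρ i) ⟩
      𝟘                                   ∎

  conj≡ : ∀ a b → conj (a , b) ≡ (a , - b)
  conj≡ a b = ≡.trans (conj-via-ε a b) (≡.trans (≡.cong (λ t → emb a ⊕ t ⊗ emb b) conj-ε≡-ε) real-minus-ε)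
    where
    conj-ε≡-ε : conj ε ≡ ⊖ ε
    conj-ε≡-ε = [ (λ conj-ε≡ε → ⊥-elim (conj-ε≢ε conj-ε≡ε)) , (λ conj-ε≡-ε → conj-ε≡-ε) ]′ conj-ε≡±ε
    real-minus-ε : emb a ⊕ ⊖ ε ⊗ emb b ≡ (a , - b)
    real-minus-ε = ≡.cong₂ _,_
      (solve 3 (λ w a b → a :+ ((:- :0) :* b :+ w :* ((:- :1) :* :0)) := a) ≡.refl w a b)
      (solve 2 (λ a b → :0 :+ ((:- :0) :* :0 :+ (:- :1) :* b) := :- b) ≡.refl a b)

  N≡norm : ∀ x → N x ≡ emb (norm x)
  N≡norm (a , b) = begin
    (a , b) ⊗ conj (a , b)   ≡⟨ ≡.cong ((a , b) ⊗_) (conj≡ a b) ⟩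
    (a , b) ⊗ (a , - b)      ≡⟨ ≡.cong₂ _,_
                                  (solve 3 (λ w a b → a :* a :+ w :* (b :* (:- b)) := a :* a :- w :* (b :* b)) ≡.refl w a b)
                                  (solve 2 (λ a b → a :* (:- b) :+ b :* a := :0) ≡.refl a b) ⟩
    emb (norm (a , b))       ∎

  T≡twice-real-part : ∀ x → T x ≡ emb (proj₁ x + proj₁ x)
  T≡twice-real-part (a , b) = begin
    (a , b) ⊕ conj (a , b)   ≡⟨ ≡.cong ((a , b) ⊕_) (conj≡ a b) ⟩
    (a , b) ⊕ (a , - b)      ≡⟨ ≡.cong (a + a ,_) (solve 1 (λ b → b :+ :- b := :0) ≡.refl b) ⟩
    emb (a + a)              ∎

module ProjectivePlane (F : FiniteField) (w : FiniteField.Carrier F)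
  (w-nonsquare : ∀ s → FiniteField._*_ F s s ≢ w) where
  open import Data.Product using (_×_; _,_; proj₁; proj₂)
  open import Function.Base using (_∘_)
  open ≡.≡-Reasoning

  open QuadraticExtension F w w-nonsquare
  private
    module ᴳRing = CommutativeRing ᴳ.commutativeRing
  open IntegerRingSolver ᴳ.commutativeRing using (solve; _:+_; _:*_; _:-_; :0; :1; _:=_)

  triple-≡ : ∀ {a b c a′ b′ c′ : GF} → a ≡ a′ → b ≡ b′ → c ≡ c′ → (a , b , c) ≡ (a′ , b′ , c′)
  triple-≡ ≡.refl ≡.refl ≡.refl = ≡.refl

  scale-𝟙 : ∀ u → scale 𝟙 u ≡ u
  scale-𝟙 (a , b , c) = triple-≡ (ᴳRing.*-identityˡ a) (ᴳRing.*-identityˡ b) (ᴳRing.*-identityˡ c)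

  scale-scale : ∀ m k u → scale m (scale k u) ≡ scale (m ⊗ k) u
  scale-scale m k (a , b , c) = ≡.sym (triple-≡ (ᴳRing.*-assoc m k a) (ᴳRing.*-assoc m k b) (ᴳRing.*-assoc m k c))

  ∼-refl : ∀ u → u ∼ u
  ∼-refl u = 𝟙 , 𝟙≢𝟘 , ≡.sym (scale-𝟙 u)

  ∼-sym : ∀ {u v} → u ∼ v → v ∼ u
  ∼-sym {u} {v} (k , k≢0 , v≡ku) = k⁻¹ , k⁻¹≢0 , (begin
    u                   ≡⟨ scale-𝟙 u ⟨
    scale 𝟙 u           ≡⟨ ≡.cong (λ t → scale t u) k⁻¹k≡1 ⟨
    scale (k⁻¹ ⊗ k) u   ≡⟨ scale-scale k⁻¹ k u ⟨
    scale k⁻¹ (scale k u) ≡⟨ ≡.cong (scale k⁻¹) v≡ku ⟨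
    scale k⁻¹ v         ∎)
    where
    k⁻¹ = proj₁ (inverse-GF k k≢0)
    k⁻¹k≡1 : k⁻¹ ⊗ k ≡ 𝟙
    k⁻¹k≡1 = ≡.trans (ᴳRing.*-comm k⁻¹ k) (proj₂ (inverse-GF k k≢0))
    k⁻¹≢0 : k⁻¹ ≢ 𝟘
    k⁻¹≢0 k⁻¹≡0 = 𝟙≢𝟘 (≡.trans (≡.sym k⁻¹k≡1) (≡.trans (≡.cong (_⊗ k) k⁻¹≡0) (ᴳRing.zeroˡ k)))

  ∼-trans : ∀ {u v t} → u ∼ v → v ∼ t → u ∼ t
  ∼-trans {u} (k , k≢0 , v≡ku) (m , m≢0 , t≡mv) =
    m ⊗ k , ᴳ.*-≢0 m≢0 k≢0 , ≡.trans t≡mv (≡.trans (≡.cong (scale m) v≡ku) (scale-scale m k u))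

  cross-scaleʳ : ∀ P k Q → cross P (scale k Q) ≡ scale k (cross P Q)
  cross-scaleʳ (a , b , c) k (x , y , z) = triple-≡ (lemma b c y z) (lemma c a z x) (lemma a b x y)
    where
    lemma : ∀ b c y z → b ⊗ (k ⊗ z) ⊝ c ⊗ (k ⊗ y) ≡ k ⊗ (b ⊗ z ⊝ c ⊗ y)
    lemma = solve 5 (λ k b c y z → b :* (k :* z) :- c :* (k :* y) := k :* (b :* z :- c :* y)) ≡.refl k

  dot-scaleʳ : ∀ R k L → dot R (scale k L) ≡ k ⊗ dot R L
  dot-scaleʳ (a , b , c) k (x , y , z) =
    solve 7 (λ k a b c x y z → a :* (k :* x) :+ b :* (k :* y) :+ c :* (k :* z) := k :* (a :* x :+ b :* y :+ c :* z)) ≡.refl k a b c x y z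

  dot-scaleˡ : ∀ k R L → dot (scale k R) L ≡ k ⊗ dot R L
  dot-scaleˡ k (a , b , c) (x , y , z) =
    solve 7 (λ k a b c x y z → (k :* a) :* x :+ (k :* b) :* y :+ (k :* c) :* z := k :* (a :* x :+ b :* y :+ c :* z)) ≡.refl k a b c x y z

  dot-crossˡ : ∀ Q Q′ → dot Q (cross Q Q′) ≡ 𝟘
  dot-crossˡ (a , b , c) (x , y , z) =
    solve 6 (λ a b c x y z → a :* (b :* z :- c :* y) :+ b :* (c :* x :- a :* z) :+ c :* (a :* y :- b :* x) := :0) ≡.refl a b c x y z

  dot-crossʳ : ∀ Q Q′ → dot Q′ (cross Q Q′) ≡ 𝟘
  dot-crossʳ (a , b , c) (x , y , z) =
    solve 6 (λ a b c x y z → x :* (b :* z :- c :* y) :+ y :* (c :* x :- a :* z) :+ z :* (a :* y :- b :* x) := :0) ≡.refl a b c x y z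

  incident-scaleˡ : ∀ {k R L} → k ≢ 𝟘 → Incident (scale k R) L → Incident R L
  incident-scaleˡ {k} {R} {L} k≢0 kR∈L = ᴳ.x≢0⇒x*y≡0⇒y≡0 k≢0 (≡.trans (≡.sym (dot-scaleˡ k R L)) kR∈L)

  incident-scaleʳ : ∀ {k R L} → k ≢ 𝟘 → Incident R (scale k L) → Incident R L
  incident-scaleʳ {k} {R} {L} k≢0 R∈kL = ᴳ.x≢0⇒x*y≡0⇒y≡0 k≢0 (≡.trans (≡.sym (dot-scaleʳ R k L)) R∈kL)

  incident-∼ : ∀ {R R′ L} → R ∼ R′ → Incident R L → Incident R′ L
  incident-∼ {R} {R′} {L} (k , _ , R′≡kR) R∈L = begin
    dot R′ L             ≡⟨ ≡.cong (λ t → dot t L) R′≡kR ⟩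
    dot (scale k R) L    ≡⟨ dot-scaleˡ k R L ⟩
    k ⊗ dot R L          ≡⟨ ≡.cong (k ⊗_) R∈L ⟩
    k ⊗ 𝟘                ≡⟨ ᴳRing.zeroʳ k ⟩
    𝟘                    ∎

  incident-scale : ∀ k {R L} → Incident R L → Incident R (scale k L)
  incident-scale k {R} {L} R∈L = ≡.trans (dot-scaleʳ R k L) (≡.trans (≡.cong (k ⊗_) R∈L) (ᴳRing.zeroʳ k))

  ∼-affine : ∀ {a b a′ b′} → (a , b , 𝟙) ∼ (a′ , b′ , 𝟙) → a ≡ a′ × b ≡ b′
  ∼-affine {a} {b} (k , _ , eq) = ≡.trans (≡.sym (ᴳRing.*-identityˡ a)) (≡.trans (≡.cong (_⊗ a) k≡1) (≡.sym (≡.cong proj₁ eq)))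
                               , ≡.trans (≡.sym (ᴳRing.*-identityˡ b)) (≡.trans (≡.cong (_⊗ b) k≡1) (≡.sym (≡.cong (proj₁ ∘ proj₂) eq)))
    where
    k≡1 : 𝟙 ≡ k
    k≡1 = ≡.trans (≡.cong (proj₂ ∘ proj₂) eq) (ᴳRing.*-identityʳ k)

  join-axis-P∞ : ∀ b Y → Incident (𝟘 , Y , 𝟙) (cross (𝟘 , b , 𝟙) P∞)
  join-axis-P∞ = solve 2 (λ b Y → :0 :* (b :* :0 :- :1 :* :1) :+ Y :* (:1 :* :0 :- :0 :* :0) :+ :1 :* (:0 :* :1 :- b :* :0) := :0) ≡.refl

  join-axis-axis : ∀ b Y Y′ → Incident (𝟘 , Y′ , 𝟙) (cross (𝟘 , b , 𝟙) (𝟘 , Y , 𝟙))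
  join-axis-axis = solve 3 (λ b Y Y′ → :0 :* (b :* :1 :- :1 :* Y) :+ Y′ :* (:1 :* :0 :- :0 :* :1) :+ :1 :* (:0 :* Y :- b :* :0) := :0) ≡.refl

  join-axis-affine : ∀ b z Y t Y′ → dot (t ⊗ z , Y′ , 𝟙) (cross (𝟘 , b , 𝟙) (z , Y , 𝟙)) ≡ z ⊗ (Y′ ⊝ (b ⊕ t ⊗ (Y ⊝ b)))
  join-axis-affine = solve 5 (λ b z Y t Y′ →
    (t :* z) :* (b :* :1 :- :1 :* Y) :+ Y′ :* (:1 :* z :- :0 :* :1) :+ :1 :* (:0 :* Y :- b :* z) := z :* (Y′ :- (b :+ t :* (Y :- b)))) ≡.refl

  join-affine-affine : ∀ x X y Y z Z → dot (z , Z , 𝟙) (cross (x , X , 𝟙) (y , Y , 𝟙)) ≡ (y ⊝ x) ⊗ (Z ⊝ X) ⊝ (z ⊝ x) ⊗ (Y ⊝ X)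
  join-affine-affine = solve 6 (λ x X y Y z Z →
    z :* (X :* :1 :- :1 :* Y) :+ Z :* (:1 :* y :- x :* :1) :+ :1 :* (x :* Y :- X :* y) := (y :- x) :* (Z :- X) :- (z :- x) :* (Y :- X)) ≡.refl

module Feet (F : FiniteField) (w : FiniteField.Carrier F)
  (w-nonsquare : ∀ s → FiniteField._*_ F s s ≢ w)
  {p n : ℕ} (p-prime : Prime p) (p≢2 : p ≢ 2) (size≡p^n : FiniteField.size F ≡ p ℕ.^ n)
  (α β : GF2.GF F w) (l : FiniteField.Carrier F) where
  open import Data.Product as Σ using (Σ; _×_; _,_; proj₁; proj₂)
  open import Data.Sum as ⊎ using (_⊎_; inj₁; inj₂; [_,_]′)
  open import Data.Empty using (⊥-elim)
  open import Relation.Nullary using (¬_; yes; no)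
  open import Relation.Nullary.Decidable using (decidable-stable; _×-dec_)
  open ≡.≡-Reasoning

  open FiniteField F
  open FiniteFieldProperties F hiding (_×_; _^_)
  open OddCharacteristic {n = n} p-prime p≢2 size≡p^n using (1+1≢0)
  open QuadraticExtension F w w-nonsquare
  open Conjugation F w w-nonsquare {n = n} p-prime p≢2 size≡p^n using (N≡norm; T≡twice-real-part)
  open ProjectivePlane F w w-nonsquare
  open CommutativeRing commutativeRing using (_-_; +-identityʳ; *-identityʳ; zeroʳ; *-comm)
  open IntegerRingSolver commutativeRing using (solve; Polynomial; _:+_; _:*_; _:-_; :-_; :0; :1; _:=_)
  private
    module ᴳRing = CommutativeRing ᴳ.commutativeRing
    module ᴳSolver = IntegerRingSolver ᴳ.commutativeRing

  P : Triple
  P = Pλ l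

  λε : GF
  λε = emb l ⊗ ε

  unitalY : GF → Carrier → GF
  unitalY x r = α ⊗ x ⊗ x ⊕ β ⊗ N x ⊕ emb r

  point : GF → Carrier → Triple
  point x r = (x , unitalY x r , 𝟙)

  point∈U : ∀ x r → InU α β (point x r)
  point∈U x r = inj₂ (x , r , ∼-refl (point x r))

  InU-∼ : ∀ {Q R} → InU α β Q → Q ∼ R → InU α β R
  InU-∼ (inj₁ P∞∼Q) Q∼R = inj₁ (∼-trans P∞∼Q Q∼R)
  InU-∼ (inj₂ (x , r , A∼Q)) Q∼R = inj₂ (x , r , ∼-trans A∼Q Q∼R)

  foot-∼ : ∀ {S Q R} → Foot α β S Q → Q ∼ R → Foot α β S R
  foot-∼ {S} {Q} {R} (S∉U , Q∈U , tangent) Q∼R@(k , k≢0 , R≡kQ) = S∉U , InU-∼ Q∈U Q∼R ,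
    λ R′ R′∈U R′∈SR → ∼-trans (∼-sym Q∼R) (tangent R′ R′∈U (incident-scaleʳ k≢0
      (≡.subst (Incident R′) (≡.trans (≡.cong (cross S) R≡kQ) (cross-scaleʳ S k Q)) R′∈SR)))

  tangency : GF → Carrier
  tangency z = proj₂ (α ⊗ z ⊗ z) + proj₂ β * norm z + l

  FootCondition : GF → Set
  FootCondition z = tangency z ≡ 0#

  on-tangent-line : ∀ {R z Y} → Foot α β P R → (z , Y , 𝟙) ∼ R →
    ∀ z′ r′ → Incident (point z′ r′) (cross P (z , Y , 𝟙)) → z′ ≡ z × unitalY z′ r′ ≡ Y
  on-tangent-line {R} {z} {Y} (_ , _ , tangent) A∼R@(k , _ , R≡kA) z′ r′ X∈PA =
    Σ.map ≡.sym ≡.sym (∼-affine (∼-trans A∼R (tangent (point z′ r′) (point∈U z′ r′) X∈PR)))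
    where
    X∈PR : Incident (point z′ r′) (cross P R)
    X∈PR = ≡.subst (λ L → Incident (point z′ r′) L)
      (≡.trans (≡.sym (cross-scaleʳ P k (z , Y , 𝟙))) (≡.cong (cross P) (≡.sym R≡kA))) (incident-scale k X∈PA)

  foot≁P∞ : ∀ {R} → Foot α β P R → ¬ (P∞ ∼ R)
  foot≁P∞ {R} (_ , _ , tangent) P∞∼R@(k , _ , R≡kP∞) =
    𝟙≢𝟘 (≡.trans (≡.cong (λ u → proj₂ (proj₂ u)) X≡mkP∞) (ᴳRing.zeroʳ m))
    where
    X∈PR : Incident (point 𝟘 0#) (cross P R)
    X∈PR = ≡.subst (λ L → Incident (point 𝟘 0#) L)
      (≡.trans (≡.sym (cross-scaleʳ P k P∞)) (≡.cong (cross P) (≡.sym R≡kP∞)))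
      (incident-scale k (join-axis-P∞ λε (unitalY 𝟘 0#)))
    P∞∼X = ∼-trans P∞∼R (tangent (point 𝟘 0#) (point∈U 𝟘 0#) X∈PR)
    m = proj₁ P∞∼X
    X≡mkP∞ = proj₂ (proj₂ P∞∼X)

  foot-off-axis : ∀ {R} r → Foot α β P R → ¬ (point 𝟘 r ∼ R)
  foot-off-axis {R} r foot A∼R = 0≢1 (≡.sym (begin
    1#                                 ≡⟨ solve 2 (λ x r → :1 := (x :+ (r :+ :1)) :- (x :+ r)) ≡.refl X₀ r ⟩
    (X₀ + (r + 1#)) - (X₀ + r)         ≡⟨ ≡.cong (λ t → t - (X₀ + r)) (≡.cong proj₁ next≡this) ⟩
    (X₀ + r) - (X₀ + r)                ≡⟨ -‿inverseʳ (X₀ + r) ⟩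
    0#                                 ∎))
    where
    open CommutativeRing commutativeRing using (-‿inverseʳ)
    X₀ = proj₁ (α ⊗ 𝟘 ⊗ 𝟘 ⊕ β ⊗ N 𝟘)
    next≡this : unitalY 𝟘 (r + 1#) ≡ unitalY 𝟘 r
    next≡this = proj₂ (on-tangent-line foot A∼R 𝟘 (r + 1#) (join-axis-axis λε (unitalY 𝟘 r) (unitalY 𝟘 (r + 1#))))

  module AwayFromAxis {R z r} (foot : Foot α β P R) (A∼R : point z r ∼ R) (z≢0 : z ≢ 𝟘) (α≢0 : α ≢ 𝟘) where

    αz² = α ⊗ z ⊗ z
    ν = norm z
    l₁ l₂ : Carrier
    l₁ = proj₂ αz² + proj₂ β * ν + l
    l₂ = proj₁ αz² - proj₁ β * ν - r

    open BinaryForms 1+1≢0 l₁ l₂ (proj₂ αz² + proj₂ β * ν) (proj₁ αz² + proj₁ αz²) (w * (proj₂ αz² - proj₂ β * ν))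

    Y = unitalY z r

    Y≡ : Y ≡ αz² ⊕ β ⊗ emb ν ⊕ emb r
    Y≡ = ≡.cong (λ u → αz² ⊕ β ⊗ u ⊕ emb r) (N≡norm z)

    -- The point of the line P[z, Y, 1] with first coordinate tz, t = 1 + μd, is on U iff the imaginary parts of
    -- α(tz)² + βN(tz) and of its second coordinate agree; their difference is μ(L(d) + μQ(d)).
    imaginary-gap : ∀ μ d₁ d₂ → let t = (1# + μ * d₁ , μ * d₂) in
      proj₂ ((t ⊗ t) ⊗ αz² ⊕ β ⊗ emb (norm t * ν)) - proj₂ (λε ⊕ t ⊗ (αz² ⊕ β ⊗ emb ν ⊕ emb r ⊝ λε))
        ≡ μ * (linear (d₁ , d₂) + μ * quadratic (d₁ , d₂))
    imaginary-gap μ d₁ d₂ = solve 11 (λ W μ d₁ d₂ c₁ c₂ β₁ β₂ ν l r →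
        let open QuadraticExtension.Componentwise F w w-nonsquare W
            t = (:1 :+ μ :* d₁ , μ :* d₂)
            c = (c₁ , c₂)
            b = (β₁ , β₂)
            λεₚ = embₚ l ⊗ₚ εₚ
        in proj₂ ((t ⊗ₚ t) ⊗ₚ c ⊕ₚ b ⊗ₚ embₚ (NormP t :* ν)) :- proj₂ (λεₚ ⊕ₚ t ⊗ₚ (c ⊕ₚ b ⊗ₚ embₚ ν ⊕ₚ embₚ r ⊝ₚ λεₚ))
           := μ :* (((c₂ :+ β₂ :* ν :+ l) :* d₁ :+ (c₁ :- β₁ :* ν :- r) :* d₂)
                   :+ μ :* ((c₂ :+ β₂ :* ν) :* (d₁ :* d₁) :+ (c₁ :+ c₁) :* (d₁ :* d₂) :+ (W :* (c₂ :- β₂ :* ν)) :* (d₂ :* d₂))))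
      ≡.refl w μ d₁ d₂ (proj₁ αz²) (proj₂ αz²) (proj₁ β) (proj₂ β) ν l r

    -- The second root μ = −L(d)/Q(d) of μ(L(d) + μQ(d)) gives a point of U on the tangent line at t = 1 + μd,
    -- so t = 1 and d = 0.
    module SecondIntersection {d₁ d₂ : Carrier} (L≢0 : linear (d₁ , d₂) ≢ 0#) (Q≢0 : quadratic (d₁ , d₂) ≢ 0#) where
      L = linear (d₁ , d₂)
      Q = quadratic (d₁ , d₂)
      Q⁻¹ = proj₁ (inverse Q Q≢0)
      μ = - L * Q⁻¹

      L+μQ≡0 : L + μ * Q ≡ 0#
      L+μQ≡0 = begin
        L + (- L * Q⁻¹) * Q     ≡⟨ solve 3 (λ L Q I → L :+ (:- L :* I) :* Q := L :- L :* (Q :* I)) ≡.refl L Q Q⁻¹ ⟩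
        L - L * (Q * Q⁻¹)       ≡⟨ ≡.cong (λ u → L - L * u) (proj₂ (inverse Q Q≢0)) ⟩
        L - L * 1#              ≡⟨ solve 1 (λ L → L :- L :* :1 := :0) ≡.refl L ⟩
        0#                      ∎

      t = (1# + μ * d₁ , μ * d₂)
      Y′ = λε ⊕ t ⊗ (Y ⊝ λε)
      X = (t ⊗ t) ⊗ αz² ⊕ β ⊗ emb (norm t * ν)
      r′ = proj₁ Y′ - proj₁ X

      X≡Y′-imaginary : proj₂ X ≡ proj₂ Y′
      X≡Y′-imaginary = x-y≡0⇒x≡y (begin
        proj₂ X - proj₂ Y′                                                   ≡⟨ ≡.cong (λ u → proj₂ X - proj₂ (λε ⊕ t ⊗ (u ⊝ λε))) Y≡ ⟩
        proj₂ X - proj₂ (λε ⊕ t ⊗ (αz² ⊕ β ⊗ emb ν ⊕ emb r ⊝ λε))            ≡⟨ imaginary-gap μ d₁ d₂ ⟩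
        μ * (L + μ * Q)                                                      ≡⟨ ≡.cong (μ *_) L+μQ≡0 ⟩
        μ * 0#                                                               ≡⟨ zeroʳ μ ⟩
        0#                                                                   ∎)

      unitalY≡Y′ : unitalY (t ⊗ z) r′ ≡ Y′
      unitalY≡Y′ = begin
        α ⊗ (t ⊗ z) ⊗ (t ⊗ z) ⊕ β ⊗ N (t ⊗ z) ⊕ emb r′   ≡⟨ ≡.cong₂ (λ u v → u ⊕ β ⊗ v ⊕ emb r′) square-scaled N-scaled ⟩
        X ⊕ emb r′                                       ≡⟨ ≡.cong₂ _,_ (solve 2 (λ x y → x :+ (y :- x) := y) ≡.refl (proj₁ X) (proj₁ Y′))
                                                                          (≡.trans (+-identityʳ (proj₂ X)) X≡Y′-imaginary) ⟩
        Y′                                               ∎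
        where
        square-scaled : α ⊗ (t ⊗ z) ⊗ (t ⊗ z) ≡ (t ⊗ t) ⊗ αz²
        square-scaled = ᴳSolver.solve 3 (λ a t z → a ᴳSolver.:* (t ᴳSolver.:* z) ᴳSolver.:* (t ᴳSolver.:* z) ᴳSolver.:= (t ᴳSolver.:* t) ᴳSolver.:* (a ᴳSolver.:* z ᴳSolver.:* z)) ≡.refl α t z
        N-scaled : N (t ⊗ z) ≡ emb (norm t * ν)
        N-scaled = ≡.trans (N≡norm (t ⊗ z)) (≡.cong emb (norm-⊗ t z))

      on-line : Incident (point (t ⊗ z) r′) (cross P (z , Y , 𝟙))
      on-line = begin
        dot (t ⊗ z , unitalY (t ⊗ z) r′ , 𝟙) (cross P (z , Y , 𝟙))   ≡⟨ join-axis-affine λε z Y t (unitalY (t ⊗ z) r′) ⟩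
        z ⊗ (unitalY (t ⊗ z) r′ ⊝ Y′)                                 ≡⟨ ≡.cong (λ u → z ⊗ (u ⊝ Y′)) unitalY≡Y′ ⟩
        z ⊗ (Y′ ⊝ Y′)                                                 ≡⟨ ≡.cong (z ⊗_) (ᴳRing.-‿inverseʳ Y′) ⟩
        z ⊗ 𝟘                                                         ≡⟨ ᴳRing.zeroʳ z ⟩
        𝟘                                                             ∎

      t≡𝟙 : t ≡ 𝟙
      t≡𝟙 = ᴳ.*-cancelˡ z≢0 (≡.trans (ᴳRing.*-comm z t) (≡.trans (proj₁ (on-tangent-line foot A∼R (t ⊗ z) r′ on-line)) (≡.sym (ᴳRing.*-identityʳ z))))

      μd₁≡0 : μ * d₁ ≡ 0#
      μd₁≡0 = begin
        μ * d₁                   ≡⟨ solve 1 (λ x → x := (:1 :+ x) :- :1) ≡.refl (μ * d₁) ⟩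
        (1# + μ * d₁) - 1#       ≡⟨ ≡.cong (_- 1#) (≡.cong proj₁ t≡𝟙) ⟩
        1# - 1#                  ≡⟨ solve 0 (:1 :- :1 := :0) ≡.refl ⟩
        0#                       ∎

      μ≢0 : μ ≢ 0#
      μ≢0 μ≡0 = L≢0 (begin
        L              ≡⟨ solve 2 (λ L Q → L := L :+ :0 :* Q) ≡.refl L Q ⟩
        L + 0# * Q     ≡⟨ ≡.cong (λ u → L + u * Q) μ≡0 ⟨
        L + μ * Q      ≡⟨ L+μQ≡0 ⟩
        0#             ∎)

      L≡0 : L ≡ 0#
      L≡0 = begin
        l₁ * d₁ + l₂ * d₂    ≡⟨ ≡.cong₂ (λ u v → l₁ * u + l₂ * v) (x≢0⇒x*y≡0⇒y≡0 μ≢0 μd₁≡0) (x≢0⇒x*y≡0⇒y≡0 μ≢0 (≡.cong proj₂ t≡𝟙)) ⟩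
        l₁ * 0# + l₂ * 0#    ≡⟨ solve 2 (λ a b → a :* :0 :+ b :* :0 := :0) ≡.refl l₁ l₂ ⟩
        0#                   ∎

    no-second-intersection : ∀ d → ¬ BothNonZeroAt d
    no-second-intersection _ (L≢0 , Q≢0) = L≢0 (SecondIntersection.L≡0 L≢0 Q≢0)

    quadratic-part≢0 : ¬ (proj₂ αz² + proj₂ β * ν ≡ 0# × proj₁ αz² + proj₁ αz² ≡ 0# × w * (proj₂ αz² - proj₂ β * ν) ≡ 0#)
    quadratic-part≢0 (sum≡0 , twice-c₁≡0 , w·difference≡0) = ᴳ.*-≢0 (ᴳ.*-≢0 α≢0 z≢0) z≢0 (≡.cong₂ _,_ c₁≡0 c₂≡0)
      where
      c₁ = proj₁ αz²
      c₂ = proj₂ αz²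
      βν = proj₂ β * ν
      c₁≡0 : c₁ ≡ 0#
      c₁≡0 = x+x≡0⇒x≡0 1+1≢0 twice-c₁≡0
      c₂≡0 : c₂ ≡ 0#
      c₂≡0 = x+x≡0⇒x≡0 1+1≢0 (begin
        c₂ + c₂                    ≡⟨ solve 2 (λ c v → c :+ c := (c :+ v) :+ (c :- v)) ≡.refl c₂ βν ⟩
        (c₂ + βν) + (c₂ - βν)      ≡⟨ ≡.cong₂ _+_ sum≡0 (x≢0⇒x*y≡0⇒y≡0 w≢0 w·difference≡0) ⟩
        0# + 0#                    ≡⟨ +-identityʳ 0# ⟩
        0#                         ∎)

    linear-part-vanishes : l₁ ≡ 0# × l₂ ≡ 0#
    linear-part-vanishes = decidable-stable (l₁ ≟ 0# ×-dec l₂ ≟ 0#)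
      (λ l≢0 → let (d , L≢0∧Q≢0) = common-non-zero l≢0 quadratic-part≢0 in no-second-intersection d L≢0∧Q≢0)

    Y≡Q-coordinate : Y ≡ T αz² ⊝ λε
    Y≡Q-coordinate = begin
      Y                                  ≡⟨ Y≡ ⟩
      αz² ⊕ β ⊗ emb ν ⊕ emb r            ≡⟨ ≡.cong₂ _,_ (x-y≡0⇒x≡y real-gap) (x-y≡0⇒x≡y imaginary-gap′) ⟩
      emb (proj₁ αz² + proj₁ αz²) ⊝ λε   ≡⟨ ≡.cong (_⊝ λε) (T≡twice-real-part αz²) ⟨
      T αz² ⊝ λε                         ∎
      where
      real-gap : proj₁ (αz² ⊕ β ⊗ emb ν ⊕ emb r) - proj₁ (emb (proj₁ αz² + proj₁ αz²) ⊝ λε) ≡ 0#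
      real-gap = ≡.trans (solve 8 (λ W c₁ c₂ β₁ β₂ ν l r →
          let open QuadraticExtension.Componentwise F w w-nonsquare W
              c = (c₁ , c₂)
              b = (β₁ , β₂)
          in proj₁ (c ⊕ₚ b ⊗ₚ embₚ ν ⊕ₚ embₚ r) :- proj₁ (embₚ (c₁ :+ c₁) ⊝ₚ embₚ l ⊗ₚ εₚ) := :- (c₁ :- β₁ :* ν :- r))
        ≡.refl w (proj₁ αz²) (proj₂ αz²) (proj₁ β) (proj₂ β) ν l r)
        (≡.trans (≡.cong -_ (proj₂ linear-part-vanishes)) (solve 0 (:- :0 := :0) ≡.refl))
      imaginary-gap′ : proj₂ (αz² ⊕ β ⊗ emb ν ⊕ emb r) - proj₂ (emb (proj₁ αz² + proj₁ αz²) ⊝ λε) ≡ 0#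
      imaginary-gap′ = ≡.trans (solve 8 (λ W c₁ c₂ β₁ β₂ ν l r →
          let open QuadraticExtension.Componentwise F w w-nonsquare W
              c = (c₁ , c₂)
              b = (β₁ , β₂)
          in proj₂ (c ⊕ₚ b ⊗ₚ embₚ ν ⊕ₚ embₚ r) :- proj₂ (embₚ (c₁ :+ c₁) ⊝ₚ embₚ l ⊗ₚ εₚ) := c₂ :+ β₂ :* ν :+ l)
        ≡.refl w (proj₁ αz²) (proj₂ αz²) (proj₁ β) (proj₂ β) ν l r)
        (proj₁ linear-part-vanishes)

    Q∼R : Qz α l z ∼ R
    Q∼R = ≡.subst (_∼ R) (≡.cong (λ u → (z , u , 𝟙)) Y≡Q-coordinate) A∼R

  foot-form : α ≢ 𝟘 → ∀ {R} → Foot α β P R → Σ GF λ z → Qz α l z ∼ R × FootCondition z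
  foot-form α≢0 foot@(_ , inj₁ P∞∼R , _) = ⊥-elim (foot≁P∞ foot P∞∼R)
  foot-form α≢0 foot@(_ , inj₂ (z , r , A∼R) , _) with z ≟ᴳ 𝟘
  ... | yes ≡.refl = ⊥-elim (foot-off-axis r foot A∼R)
  ... | no z≢0 = z , Q∼R , proj₁ linear-part-vanishes
    where open AwayFromAxis foot A∼R z≢0 α≢0

  foot-condition : α ≢ 𝟘 → ∀ x → Foot α β P (Qz α l x) → FootCondition x
  foot-condition α≢0 x foot with foot-form α≢0 foot
  ... | z , Qz∼Qx , condition = ≡.subst FootCondition (proj₁ (∼-affine Qz∼Qx)) condition

  trace-α : GF → Carrier
  trace-α v = proj₁ (α ⊗ v ⊗ v) + proj₁ (α ⊗ v ⊗ v)

  private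
    second-difference-trace : ∀ x d μ →
      trace-α (x ⊕ d ⊗ emb μ) - trace-α x - μ * (trace-α (x ⊕ d) - trace-α x) ≡ (μ * μ - μ) * trace-α d
    second-difference-trace (x₁ , x₂) (d₁ , d₂) μ = solve 8 (λ W a₁ a₂ x₁ x₂ d₁ d₂ μ →
        let open QuadraticExtension.Componentwise F w w-nonsquare W
            a = (a₁ , a₂)
            tr : Pair → Polynomial _
            tr v = proj₁ (a ⊗ₚ v ⊗ₚ v) :+ proj₁ (a ⊗ₚ v ⊗ₚ v)
            x = (x₁ , x₂)
            d = (d₁ , d₂)
        in tr (x ⊕ₚ d ⊗ₚ embₚ μ) :- tr x :- μ :* (tr (x ⊕ₚ d) :- tr x) := (μ :* μ :- μ) :* tr d)
      ≡.refl w (proj₁ α) (proj₂ α) x₁ x₂ d₁ d₂ μ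

    second-difference-tangency : ∀ x d μ →
      tangency (x ⊕ d ⊗ emb μ) - tangency x - μ * (tangency (x ⊕ d) - tangency x)
        ≡ (μ * μ - μ) * (proj₂ (α ⊗ d ⊗ d) + proj₂ β * norm d)
    second-difference-tangency (x₁ , x₂) (d₁ , d₂) μ = solve 10 (λ W a₁ a₂ β₂ l x₁ x₂ d₁ d₂ μ →
        let open QuadraticExtension.Componentwise F w w-nonsquare W
            a = (a₁ , a₂)
            K : Pair → Polynomial _
            K v = proj₂ (a ⊗ₚ v ⊗ₚ v) :+ β₂ :* NormP v :+ l
            x = (x₁ , x₂)
            d = (d₁ , d₂)
        in K (x ⊕ₚ d ⊗ₚ embₚ μ) :- K x :- μ :* (K (x ⊕ₚ d) :- K x) := (μ :* μ :- μ) :* (proj₂ (a ⊗ₚ d ⊗ₚ d) :+ β₂ :* NormP d))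
      ≡.refl w (proj₁ α) (proj₂ α) (proj₂ β) l x₁ x₂ d₁ d₂ μ

    norm-identity : ∀ d → let re = proj₁ (α ⊗ d ⊗ d) ; im = proj₂ (α ⊗ d ⊗ d) ; β₂ = proj₂ β in
      (norm α + w * (β₂ * β₂)) * (norm d * norm d) ≡ re * re + w * ((β₂ * norm d - im) * (im + β₂ * norm d))
    norm-identity (d₁ , d₂) = solve 6 (λ W a₁ a₂ d₁ d₂ β₂ →
        let open QuadraticExtension.Componentwise F w w-nonsquare W
            a = (a₁ , a₂)
            d = (d₁ , d₂)
            re = proj₁ (a ⊗ₚ d ⊗ₚ d)
            im = proj₂ (a ⊗ₚ d ⊗ₚ d)
        in (NormP a :+ W :* (β₂ :* β₂)) :* (NormP d :* NormP d) := re :* re :+ W :* ((β₂ :* NormP d :- im) :* (im :+ β₂ :* NormP d)))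
      ≡.refl w (proj₁ α) (proj₂ α) d₁ d₂ (proj₂ β)

  discriminant≡ : (𝟙 ⊕ 𝟙 ⊕ 𝟙 ⊕ 𝟙) ⊗ N α ⊕ (conj β ⊝ β) ⊗ (conj β ⊝ β) ≡ emb ((1# + 1# + 1# + 1#) * (norm α + w * (proj₂ β * proj₂ β)))
  discriminant≡ = begin
    (𝟙 ⊕ 𝟙 ⊕ 𝟙 ⊕ 𝟙) ⊗ N α ⊕ (conj β ⊝ β) ⊗ (conj β ⊝ β)                 ≡⟨ ≡.cong₂ (λ u v → (𝟙 ⊕ 𝟙 ⊕ 𝟙 ⊕ 𝟙) ⊗ u ⊕ (v ⊝ β) ⊗ (v ⊝ β)) (N≡norm α) (conj≡ (proj₁ β) (proj₂ β)) ⟩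
    (𝟙 ⊕ 𝟙 ⊕ 𝟙 ⊕ 𝟙) ⊗ emb (norm α) ⊕ (β̄ ⊝ β) ⊗ (β̄ ⊝ β)               ≡⟨ ≡.cong₂ _,_ real-part imaginary-part ⟩
    emb ((1# + 1# + 1# + 1#) * (norm α + w * (proj₂ β * proj₂ β)))       ∎
    where
    open Conjugation F w w-nonsquare {n = n} p-prime p≢2 size≡p^n using (conj≡)
    β̄ = (proj₁ β , - proj₂ β)
    real-part = solve 5 (λ W a₁ a₂ b₁ b₂ →
        let open QuadraticExtension.Componentwise F w w-nonsquare W
            b = (b₁ , b₂)
            b̄ = (b₁ , :- b₂)
        in proj₁ ((𝟙ₚ ⊕ₚ 𝟙ₚ ⊕ₚ 𝟙ₚ ⊕ₚ 𝟙ₚ) ⊗ₚ embₚ (NormP (a₁ , a₂)) ⊕ₚ (b̄ ⊝ₚ b) ⊗ₚ (b̄ ⊝ₚ b))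
             := (:1 :+ :1 :+ :1 :+ :1) :* (NormP (a₁ , a₂) :+ W :* (b₂ :* b₂)))
      ≡.refl w (proj₁ α) (proj₂ α) (proj₁ β) (proj₂ β)
    imaginary-part = solve 5 (λ W a₁ a₂ b₁ b₂ →
        let open QuadraticExtension.Componentwise F w w-nonsquare W
            b = (b₁ , b₂)
            b̄ = (b₁ , :- b₂)
        in proj₂ ((𝟙ₚ ⊕ₚ 𝟙ₚ ⊕ₚ 𝟙ₚ ⊕ₚ 𝟙ₚ) ⊗ₚ embₚ (NormP (a₁ , a₂)) ⊕ₚ (b̄ ⊝ₚ b) ⊗ₚ (b̄ ⊝ₚ b)) := :0)
      ≡.refl w (proj₁ α) (proj₂ α) (proj₁ β) (proj₂ β)

  module Collinear
    (discriminant-nonsquare : ∀ s → emb s ⊗ emb s ≢ (𝟙 ⊕ 𝟙 ⊕ 𝟙 ⊕ 𝟙) ⊗ N α ⊕ (conj β ⊝ β) ⊗ (conj β ⊝ β))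
    {x y z : GF} (x-foot : FootCondition x) (y-foot : FootCondition y) (z-foot : FootCondition z)
    (Tx≢Ty : T (α ⊗ x ⊗ x) ≢ T (α ⊗ y ⊗ y))
    (Qz∈QxQy : Incident (Qz α l z) (cross (Qz α l x) (Qz α l y))) where

    d = y ⊝ x
    Δ = trace-α y - trace-α x

    Δ≢0 : Δ ≢ 0#
    Δ≢0 Δ≡0 = Tx≢Ty (≡.trans (T≡twice-real-part (α ⊗ x ⊗ x)) (≡.trans (≡.cong emb (≡.sym (x-y≡0⇒x≡y Δ≡0))) (≡.sym (T≡twice-real-part (α ⊗ y ⊗ y)))))

    d≢0 : d ≢ 𝟘
    d≢0 d≡0 = Tx≢Ty (≡.cong (λ v → T (α ⊗ v ⊗ v)) (≡.sym (ᴳ.x-y≡0⇒x≡y d≡0)))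

    emb-⊝ : ∀ a b → emb a ⊝ emb b ≡ emb (a - b)
    emb-⊝ a b = ≡.cong (a - b ,_) (solve 0 (:0 :- :0 := :0) ≡.refl)

    chord : d ⊗ emb (trace-α z - trace-α x) ≡ (z ⊝ x) ⊗ emb Δ
    chord = ᴳ.x-y≡0⇒x≡y (begin
      d ⊗ emb (trace-α z - trace-α x) ⊝ (z ⊝ x) ⊗ emb Δ            ≡⟨ ≡.cong₂ (λ u v → d ⊗ u ⊝ (z ⊝ x) ⊗ v) (shift (trace-α z) (trace-α x)) (shift (trace-α y) (trace-α x)) ⟩
      d ⊗ (Y z ⊝ Y x) ⊝ (z ⊝ x) ⊗ (Y y ⊝ Y x)                      ≡⟨ join-affine-affine x (Y x) y (Y y) z (Y z) ⟨
      dot (z , Y z , 𝟙) (cross (x , Y x , 𝟙) (y , Y y , 𝟙))        ≡⟨ ≡.cong₂ dot (Q≡ z) (≡.cong₂ cross (Q≡ x) (Q≡ y)) ⟨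
      dot (Qz α l z) (cross (Qz α l x) (Qz α l y))                 ≡⟨ Qz∈QxQy ⟩
      𝟘                                                            ∎)
      where
      Y : GF → GF
      Y v = emb (trace-α v) ⊝ λε
      Q≡ : ∀ v → Qz α l v ≡ (v , Y v , 𝟙)
      Q≡ v = ≡.cong (λ u → (v , u ⊝ λε , 𝟙)) (T≡twice-real-part (α ⊗ v ⊗ v))
      shift : ∀ a b → emb (a - b) ≡ (emb a ⊝ λε) ⊝ (emb b ⊝ λε)
      shift a b = ≡.trans (≡.sym (emb-⊝ a b)) (≡.sym (ᴳ.[x-z]-[y-z]≡x-y (emb a) (emb b) λε))

    Δ⁻¹ = proj₁ (inverse Δ Δ≢0)
    μ = (trace-α z - trace-α x) * Δ⁻¹

    μΔ≡ : μ * Δ ≡ trace-α z - trace-α x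
    μΔ≡ = begin
      ((trace-α z - trace-α x) * Δ⁻¹) * Δ    ≡⟨ solve 3 (λ a b c → (a :* b) :* c := a :* (c :* b)) ≡.refl _ Δ⁻¹ Δ ⟩
      (trace-α z - trace-α x) * (Δ * Δ⁻¹)    ≡⟨ ≡.cong ((trace-α z - trace-α x) *_) (proj₂ (inverse Δ Δ≢0)) ⟩
      (trace-α z - trace-α x) * 1#           ≡⟨ *-identityʳ _ ⟩
      trace-α z - trace-α x                  ∎

    z≡x+μd : z ≡ x ⊕ d ⊗ emb μ
    z≡x+μd = ≡.trans (ᴳ.x≡y+[x-y] z x) (≡.cong (x ⊕_) (begin
      z ⊝ x                                              ≡⟨ ᴳRing.*-identityʳ (z ⊝ x) ⟨
      (z ⊝ x) ⊗ emb 1#                                   ≡⟨ ≡.cong (λ t → (z ⊝ x) ⊗ emb t) (proj₂ (inverse Δ Δ≢0)) ⟨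
      (z ⊝ x) ⊗ emb (Δ * Δ⁻¹)                            ≡⟨ ≡.cong ((z ⊝ x) ⊗_) (emb-⊗ Δ Δ⁻¹) ⟨
      (z ⊝ x) ⊗ (emb Δ ⊗ emb Δ⁻¹)                        ≡⟨ ᴳRing.*-assoc (z ⊝ x) (emb Δ) (emb Δ⁻¹) ⟨
      ((z ⊝ x) ⊗ emb Δ) ⊗ emb Δ⁻¹                        ≡⟨ ≡.cong (_⊗ emb Δ⁻¹) chord ⟨
      (d ⊗ emb (trace-α z - trace-α x)) ⊗ emb Δ⁻¹        ≡⟨ ᴳRing.*-assoc d _ _ ⟩
      d ⊗ (emb (trace-α z - trace-α x) ⊗ emb Δ⁻¹)        ≡⟨ ≡.cong (d ⊗_) (emb-⊗ _ _) ⟩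
      d ⊗ emb μ                                          ∎))

    y≡x+d : y ≡ x ⊕ d
    y≡x+d = ᴳ.x≡y+[x-y] y x

    [μ²-μ]·trace≡0 : (μ * μ - μ) * trace-α d ≡ 0#
    [μ²-μ]·trace≡0 = begin
      (μ * μ - μ) * trace-α d                                                            ≡⟨ second-difference-trace x d μ ⟨
      trace-α (x ⊕ d ⊗ emb μ) - trace-α x - μ * (trace-α (x ⊕ d) - trace-α x)            ≡⟨ ≡.cong₂ (λ u v → trace-α u - trace-α x - μ * (trace-α v - trace-α x)) z≡x+μd y≡x+d ⟨
      (trace-α z - trace-α x) - μ * Δ                                                    ≡⟨ ≡.cong₂ _-_ (≡.sym μΔ≡) (*-comm μ Δ) ⟩
      μ * Δ - Δ * μ                                                                      ≡⟨ solve 2 (λ a b → a :* b :- b :* a := :0) ≡.refl μ Δ ⟩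
      0#                                                                                 ∎

    [μ²-μ]·imaginary≡0 : (μ * μ - μ) * (proj₂ (α ⊗ d ⊗ d) + proj₂ β * norm d) ≡ 0#
    [μ²-μ]·imaginary≡0 = begin
      (μ * μ - μ) * (proj₂ (α ⊗ d ⊗ d) + proj₂ β * norm d)                                 ≡⟨ second-difference-tangency x d μ ⟨
      tangency (x ⊕ d ⊗ emb μ) - tangency x - μ * (tangency (x ⊕ d) - tangency x)          ≡⟨ ≡.cong₂ (λ u v → tangency u - tangency x - μ * (tangency v - tangency x)) z≡x+μd y≡x+d ⟨
      tangency z - tangency x - μ * (tangency y - tangency x)                              ≡⟨ ≡.cong₂ (λ s t → s - tangency x - μ * (t - tangency x)) z-foot y-foot ⟩
      0# - tangency x - μ * (0# - tangency x)                                              ≡⟨ ≡.cong (λ s → 0# - s - μ * (0# - s)) x-foot ⟩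
      0# - 0# - μ * (0# - 0#)                                                              ≡⟨ solve 1 (λ m → :0 :- :0 :- m :* (:0 :- :0) := :0) ≡.refl μ ⟩
      0#                                                                                   ∎

    -- Otherwise Re(αd²) = 0 = Im(αd²) + Im(β)N(d), which forces N(α) + w Im(β)² = 0.
    μ²≡μ : μ * μ - μ ≡ 0#
    μ²≡μ = decidable-stable (μ * μ - μ ≟ 0#) λ μ²-μ≢0 → discriminant-nonsquare 0# (begin
      emb 0# ⊗ emb 0#                                                                     ≡⟨ emb-⊗ 0# 0# ⟩
      emb (0# * 0#)                                                                       ≡⟨ ≡.cong emb (zeroʳ 0#) ⟩
      emb 0#                                                                              ≡⟨ ≡.cong emb (zeroʳ _) ⟨
      emb ((1# + 1# + 1# + 1#) * 0#)                                                      ≡⟨ ≡.cong (λ t → emb ((1# + 1# + 1# + 1#) * t)) (norm-part≡0 μ²-μ≢0) ⟨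
      emb ((1# + 1# + 1# + 1#) * (norm α + w * (proj₂ β * proj₂ β)))                      ≡⟨ discriminant≡ ⟨
      (𝟙 ⊕ 𝟙 ⊕ 𝟙 ⊕ 𝟙) ⊗ N α ⊕ (conj β ⊝ β) ⊗ (conj β ⊝ β)                                 ∎)
      where
      norm-part≡0 : μ * μ - μ ≢ 0# → norm α + w * (proj₂ β * proj₂ β) ≡ 0#
      norm-part≡0 μ²-μ≢0 = [ (λ h → h) , (λ Nd²≡0 → ⊥-elim (*-≢0 (norm≢0 d d≢0) (norm≢0 d d≢0) Nd²≡0)) ]′
        (x*y≡0⇒x≡0∨y≡0 _ (norm d * norm d) (begin
          (norm α + w * (β₂ * β₂)) * (norm d * norm d)            ≡⟨ norm-identity d ⟩
          re * re + w * ((β₂ * norm d - im) * (im + β₂ * norm d)) ≡⟨ ≡.cong₂ (λ u v → u * u + w * ((β₂ * norm d - im) * v)) re≡0 im+β₂Nd≡0 ⟩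
          0# * 0# + w * ((β₂ * norm d - im) * 0#)                  ≡⟨ solve 2 (λ w t → :0 :* :0 :+ w :* (t :* :0) := :0) ≡.refl w (β₂ * norm d - im) ⟩
          0#                                                       ∎))
        where
        re = proj₁ (α ⊗ d ⊗ d)
        im = proj₂ (α ⊗ d ⊗ d)
        β₂ = proj₂ β
        re≡0 : re ≡ 0#
        re≡0 = x+x≡0⇒x≡0 1+1≢0 (x≢0⇒x*y≡0⇒y≡0 μ²-μ≢0 [μ²-μ]·trace≡0)
        im+β₂Nd≡0 : im + β₂ * norm d ≡ 0#
        im+β₂Nd≡0 = x≢0⇒x*y≡0⇒y≡0 μ²-μ≢0 [μ²-μ]·imaginary≡0

    result : z ≡ x ⊎ z ≡ y
    result = ⊎.map z≡x z≡y (x*y≡0⇒x≡0∨y≡0 μ (μ - 1#) (≡.trans (solve 1 (λ m → m :* (m :- :1) := m :* m :- m) ≡.refl μ) μ²≡μ))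
      where
      z≡x : μ ≡ 0# → z ≡ x
      z≡x μ≡0 = begin
        z                   ≡⟨ z≡x+μd ⟩
        x ⊕ d ⊗ emb μ       ≡⟨ ≡.cong (λ t → x ⊕ d ⊗ emb t) μ≡0 ⟩
        x ⊕ d ⊗ 𝟘           ≡⟨ ≡.cong (x ⊕_) (ᴳRing.zeroʳ d) ⟩
        x ⊕ 𝟘               ≡⟨ ᴳRing.+-identityʳ x ⟩
        x                   ∎
      z≡y : μ - 1# ≡ 0# → z ≡ y
      z≡y μ-1≡0 = begin
        z                   ≡⟨ z≡x+μd ⟩
        x ⊕ d ⊗ emb μ       ≡⟨ ≡.cong (λ t → x ⊕ d ⊗ emb t) (x-y≡0⇒x≡y μ-1≡0) ⟩
        x ⊕ d ⊗ 𝟙           ≡⟨ ≡.cong (x ⊕_) (ᴳRing.*-identityʳ d) ⟩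
        x ⊕ d               ≡⟨ y≡x+d ⟨
        y                   ∎

open import Defs
open import Data.Nat using (ℕ; _^_)
open import Data.Nat.Primality using (Prime)
open import Data.Product using (_×_; _,_)
open import Data.Sum as ⊎ using (_⊎_; inj₁; inj₂)
open import Relation.Binary.PropositionalEquality using (_≡_; _≢_; subst)
open import Relation.Nullary using (¬_)
open import Function.Bundles using (_⇔_; mk⇔)

mainTheorem2 : (F : FiniteField) (p n : ℕ) → Prime p → p ≢ 2 →
    FiniteField.size F ≡ p ^ n →
    (w : FiniteField.Carrier F) →
    (∀ s → FiniteField._*_ F s s ≢ w) →
    let open GF2 F w in
    (α β : GF) → α ≢ 𝟘 →
    (∀ s → emb s ⊗ emb s ≢ (𝟙 ⊕ 𝟙 ⊕ 𝟙 ⊕ 𝟙) ⊗ N α ⊕ (conj β ⊝ β) ⊗ (conj β ⊝ β)) →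
    (l : FiniteField.Carrier F) → (l ≡ FiniteField.1# F ⊎ l ≡ w) →
    (x y : GF) →
    Foot α β (Pλ l) (Qz α l x) → Foot α β (Pλ l) (Qz α l y) →
    ¬ (Qz α l x ∼ Qz α l y) →
    T (α ⊗ x ⊗ x) ≢ T (α ⊗ y ⊗ y) →
    (R : Triple) →
    ((Incident R (cross (Qz α l x) (Qz α l y)) × Foot α β (Pλ l) R)
    ⇔ ((Qz α l x ∼ R) ⊎ (Qz α l y ∼ R)))
mainTheorem2 F p n p-prime p≢2 size≡p^n w w-nonsquare α β α≢0 discriminant-nonsquare l _ x y x-foot y-foot _ Tx≢Ty R =
  mk⇔ foot-on-chord⇒endpoint endpoint⇒foot-on-chord
  where
  open GF2 F w
  open ProjectivePlane F w w-nonsquare using (∼-sym; incident-∼; dot-crossˡ; dot-crossʳ)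
  open Feet F w w-nonsquare {n = n} p-prime p≢2 size≡p^n α β l
  foot-on-chord⇒endpoint : Incident R (cross (Qz α l x) (Qz α l y)) × Foot α β P R → (Qz α l x ∼ R) ⊎ (Qz α l y ∼ R)
  foot-on-chord⇒endpoint (R∈QxQy , R-foot) =
    let (z , Qz∼R , z-foot) = foot-form α≢0 R-foot
        Qz∈QxQy = incident-∼ (∼-sym Qz∼R) R∈QxQy
        z≡x∨z≡y = Collinear.result discriminant-nonsquare (foot-condition α≢0 x x-foot) (foot-condition α≢0 y y-foot) z-foot Tx≢Ty Qz∈QxQy
    in ⊎.map (λ z≡x → subst (λ v → Qz α l v ∼ R) z≡x Qz∼R) (λ z≡y → subst (λ v → Qz α l v ∼ R) z≡y Qz∼R) z≡x∨z≡y
  endpoint⇒foot-on-chord : (Qz α l x ∼ R) ⊎ (Qz α l y ∼ R) → Incident R (cross (Qz α l x) (Qz α l y)) × Foot α β P R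
  endpoint⇒foot-on-chord (inj₁ Qx∼R) = incident-∼ Qx∼R (dot-crossˡ (Qz α l x) (Qz α l y)) , foot-∼ x-foot Qx∼R
  endpoint⇒foot-on-chord (inj₂ Qy∼R) = incident-∼ Qy∼R (dot-crossʳ (Qz α l x) (Qz α l y)) , foot-∼ y-foot Qy∼R
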